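{- Let $k>1$ and let $U_1\in\mathbb{F}_q^{k\times k}$, $U_2\in\mathbb{F}_q^{k\times(k+1)}$ with $\mathrm{rk}(U_1)=\mathrm{rk}(U_2)=k$. Form the $k$-dimensional subspaces $\mathcal{U}=\mathrm{rowsp}(U_1\mid U_2)$, $\mathcal{U}'=\mathrm{rowsp}(U_1\mid 0_{k\times(k+1)})$ and $\mathcal{U}''=\mathrm{rowsp}(0_{k\times k}\mid U_2)$ of $\mathbb{F}_q^{2k+1}$. Then $\mathrm{Orb}_{\mathbf{G}}(\mathcal{U})\cup\{\mathcal{U}',\mathcal{U}''\}$ is a partial spread of $\mathbb{F}_q^{2k+1}$ of dimension $k$ with cardinality $q^{k+1}+1$.
   Context: Let $M_{k+1}\in\mathrm{GL}(k+1,q)$ be the companion matrix of a primitive polynomial of degree $k+1$ over $\mathbb{F}_q$, let $g=\begin{pmatrix}I_k&0\\0&M_{k+1}\end{pmatrix}\in\mathrm{GL}(2k+1,q)$ and $\mathbf{G}=\langle g\rangle$. $\mathrm{GL}(2k+1,q)$ acts on subspaces by $\mathcal{V}\cdot A=\mathrm{rowsp}(VA)$, and $\mathrm{Orb}_{\mathbf{G}}(\mathcal{V})=\{\mathcal{V}\cdot A\mid A\in\mathbf{G}\}$. A partial spread of dimension $k$ is a set of at least two $k$-dimensional subspaces in which distinct members intersect trivially (equivalently, minimum subspace distance $2k$). -}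

module Defs where

open import Level using (0ℓ)
open import Algebra.Bundles using (CommutativeRing)
open import Data.Nat as ℕ using (ℕ; zero; suc; _∸_; _^_; _≤_)
open import Data.Fin as Fin using (Fin; toℕ; splitAt)
open import Data.Sum using (_⊎_; inj₁; inj₂; [_,_])
open import Data.Product using (Σ; ∃; ∃₂; _×_; _,_)
open import Data.List using (List; []; _∷_; _++_; replicate)
open import Data.Unit using (⊤)
open import Relation.Nullary using (¬_; does)
open import Relation.Binary.PropositionalEquality using (_≡_)
open import Data.Bool using (if_then_else_)

record FiniteField : Set₁ where
  field
    fieldRing : CommutativeRing 0ℓ 0ℓ
  open CommutativeRing fieldRing public
  field
    0≉1       : ¬ (0# ≈ 1#)
    inverse   : ∀ x → ¬ (x ≈ 0#) → ∃ λ y → (x * y) ≈ 1#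
    size      : ℕ
    enum      : Fin size → Carrier
    enum-surj : ∀ x → ∃ λ i → enum i ≈ x
    enum-inj  : ∀ i j → enum i ≈ enum j → i ≡ j

module FieldDefs (F : FiniteField) where
  open FiniteField F
  Elt : Set
  Elt = Carrier

  q : ℕ
  q = size

  Vect : ℕ → Set
  Vect n = Fin n → Carrier

  Mat : ℕ → ℕ → Set
  Mat m n = Fin m → Fin n → Carrier

  sumF : ∀ {n} → (Fin n → Carrier) → Carrier
  sumF {zero}  f = 0#
  sumF {suc n} f = f Fin.zero + sumF (λ i → f (Fin.suc i))

  _⊗_ : ∀ {m n p} → Mat m n → Mat n p → Mat m p
  (A ⊗ B) i j = sumF (λ l → A i l * B l j)

  zeroMat : ∀ {m n} → Mat m n
  zeroMat i j = 0#

  idMat : ∀ {n} → Mat n n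
  idMat i j = if does (toℕ i ℕ.≟ toℕ j) then 1# else 0#

  _^ᴹ_ : ∀ {n} → Mat n n → ℕ → Mat n n
  A ^ᴹ zero  = idMat
  A ^ᴹ suc e = (A ^ᴹ e) ⊗ A

  _∣∣_ : ∀ {m n₁ n₂} → Mat m n₁ → Mat m n₂ → Mat m (n₁ ℕ.+ n₂)
  _∣∣_ {n₁ = n₁} A B i j = [ A i , B i ] (splitAt n₁ j)

  blockDiag : ∀ {n₁ n₂} → Mat n₁ n₁ → Mat n₂ n₂ → Mat (n₁ ℕ.+ n₂) (n₁ ℕ.+ n₂)
  blockDiag {n₁} A B i j with splitAt n₁ i | splitAt n₁ j
  ... | inj₁ a | inj₁ b = A a b
  ... | inj₂ a | inj₂ b = B a b
  ... | inj₁ _ | inj₂ _ = 0#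
  ... | inj₂ _ | inj₁ _ = 0#

  -- Polynomials over F as coefficient lists (constant coefficient first)

  Poly : Set
  Poly = List Carrier

  _+ₚ_ : Poly → Poly → Poly
  []       +ₚ q'       = q'
  (a ∷ p)  +ₚ []       = a ∷ p
  (a ∷ p)  +ₚ (b ∷ q') = (a + b) ∷ (p +ₚ q')

  scaleₚ : Carrier → Poly → Poly
  scaleₚ c []      = []
  scaleₚ c (a ∷ p) = (c * a) ∷ scaleₚ c p

  _*ₚ_ : Poly → Poly → Poly
  []      *ₚ q' = []
  (a ∷ p) *ₚ q' = scaleₚ a q' +ₚ (0# ∷ (p *ₚ q'))

  -- equality of polynomials (ignoring trailing zero coefficients)
  _≈ₚ_ : Poly → Poly → Set
  []      ≈ₚ []      = ⊤
  []      ≈ₚ (b ∷ q') = (b ≈ 0#) × ([] ≈ₚ q')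
  (a ∷ p) ≈ₚ []      = (a ≈ 0#) × (p ≈ₚ [])
  (a ∷ p) ≈ₚ (b ∷ q') = (a ≈ b) × (p ≈ₚ q')

  _∣ₚ_ : Poly → Poly → Set
  f ∣ₚ p = ∃ λ h → (f *ₚ h) ≈ₚ p

  xpow-1 : ℕ → Poly
  xpow-1 e = (replicate e 0# ++ (1# ∷ [])) +ₚ ((- 1#) ∷ [])

  -- the monic polynomial x^(n) + a_(n-1) x^(n-1) + ... + a_0 from a : Fin n → F
  monicPoly : ∀ {n} → Vect n → Poly
  monicPoly {zero}  a = 1# ∷ []
  monicPoly {suc n} a = a Fin.zero ∷ monicPoly (λ i → a (Fin.suc i))

  IsOrder : Poly → ℕ → Set
  IsOrder f e = 1 ≤ e × f ∣ₚ xpow-1 e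
              × (∀ e' → 1 ≤ e' → f ∣ₚ xpow-1 e' → e ≤ e')

  -- primitive polynomial of degree n (monic by construction):
  -- f(0) ≠ 0 and ord(f) = q^n - 1   (Lidl–Niederreiter Thm 3.16)
  Primitive : ∀ {n} → Vect n → Set
  Primitive {zero}  a = ¬ (1# ≈ 1#)   -- degree 0 polynomials are never primitive
  Primitive {suc n} a = ¬ (a Fin.zero ≈ 0#) × IsOrder (monicPoly a) (q ^ suc n ∸ 1)

  -- companion matrix of x^(n) + a_(n-1) x^(n-1) + ... + a_0:
  -- ones on the superdiagonal, last row (-a_0, ..., -a_(n-1))
  companion : ∀ {n} → Vect (suc n) → Mat (suc n) (suc n)
  companion {n} a i j =
    if does (toℕ i ℕ.≟ n) then - a j
    else (if does (toℕ j ℕ.≟ suc (toℕ i)) then 1# else 0#)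

  -- Subspaces of F^n, given as row spaces of generator matrices

  Gen : ℕ → Set
  Gen n = Σ ℕ (λ m → Mat m n)

  rowsp : ∀ {m n} → Mat m n → Gen n
  rowsp {m} V = m , V

  _∈_ : ∀ {n} → Vect n → Gen n → Set
  v ∈ (m , V) = ∃ λ (c : Vect m) → ∀ j → v j ≈ sumF (λ i → c i * V i j)

  _≐_ : ∀ {n} → Gen n → Gen n → Set
  W ≐ W' = ∀ v → (v ∈ W → v ∈ W') × (v ∈ W' → v ∈ W)

  -- rk(V) = number of rows m, i.e. the rows are linearly independent
  FullRowRank : ∀ {m n} → Mat m n → Set
  FullRowRank {m} V = ∀ (c : Vect m) → (∀ j → sumF (λ i → c i * V i j) ≈ 0#)
                      → ∀ i → c i ≈ 0#

  HasDim : ∀ {n} → Gen n → ℕ → Set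
  HasDim {n} W d = ∃ λ (B : Mat d n) → FullRowRank B × (rowsp B ≐ W)

  TrivialIntersection : ∀ {n} → Gen n → Gen n → Set
  TrivialIntersection W W' = ∀ v → v ∈ W → v ∈ W' → ∀ j → v j ≈ 0#

  -- a (set-theoretic) family of subspaces, given by a membership predicate
  -- (closed under ≐ in all uses below)
  Family : ℕ → Set₁
  Family n = Gen n → Set

  IsPartialSpread : ∀ {n} → ℕ → Family n → Set
  IsPartialSpread {n} d P =
      (∀ W → P W → HasDim W d)
    × (∀ W W' → P W → P W' → ¬ (W ≐ W') → TrivialIntersection W W')
    × (∃₂ λ W W' → P W × P W' × ¬ (W ≐ W'))

  HasCardinality : ∀ {n} → Family n → ℕ → Set
  HasCardinality {n} P N =
    ∃ λ (e : Fin N → Gen n) →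
        (∀ i → P (e i))
      × (∀ W → P W → ∃ λ i → W ≐ e i)
      × (∀ i j → e i ≐ e j → i ≡ j)

  gMat : ∀ k → Vect (suc k) → Mat (k ℕ.+ suc k) (k ℕ.+ suc k)
  gMat k a = blockDiag idMat (companion a)

  -- Orb_G(rowsp V) = { rowsp (V g^e) | e ∈ ℕ }   (G = ⟨g⟩ is finite)
  InOrbit : ∀ {m} k → Vect (suc k) → Mat m (k ℕ.+ suc k) → Gen (k ℕ.+ suc k) → Set
  InOrbit k a V W = ∃ λ e → W ≐ rowsp (V ⊗ (gMat k a ^ᴹ e))

  SpreadFamily : ∀ k → Vect (suc k) → Mat k k → Mat k (suc k) → Family (k ℕ.+ suc k)
  SpreadFamily k a U₁ U₂ W =
      InOrbit k a (U₁ ∣∣ U₂) W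
    ⊎ (W ≐ rowsp (U₁ ∣∣ zeroMat))
    ⊎ (W ≐ rowsp (zeroMat {k} {k} ∣∣ U₂))

{-# OPTIONS --safe #-}
module Submission where

-- Let f be the primitive polynomial with companion matrix M and e₀ = (1, 0, …, 0).  The map
-- p ↦ e₀ · p(M) identifies F[x]/(f) with F^(k+1), so e₀Mᵈ = e₀ exactly when f ∣ xᵈ − 1.  Hence
-- e₀ has period N = q^(k+1) − 1 under M, and counting shows that its orbit is all of
-- F^(k+1) ∖ {0}: so M^N = I and M^d has no nonzero fixed vector for 0 < d < N.  The row
-- space of (U₁ | U₂) g^e consists of the vectors (cU₁ | cU₂ Mᵉ); as U₁ and U₂ have full row
-- rank, two such spaces with e ≢ e′ (mod N) meet only in 0, and neither meets U′ or U″.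

open import Defs
import Algebra.Properties.CommutativeSemigroup
open import Data.Bool using (if_then_else_)
open import Data.Empty using (⊥-elim)
open import Data.Fin as Fin using (Fin; toℕ; splitAt; _↑ˡ_; _↑ʳ_; inject₁; fromℕ)
import Data.Fin.Properties as Finₚ
import Data.Fin.Relation.Unary.Top as Top
open import Data.List using ([]; _∷_; replicate; length) renaming (_++_ to _++ₗ_)
open import Data.Nat as ℕ using (ℕ; zero; suc)
import Data.Nat.DivMod as DivMod
open import Data.Nat.DivMod using (_%_; _/_; _mod_)
open import Data.Nat.GeneralisedArithmetic using (fold; fold-+; iterate; iterate-is-fold)
import Data.Nat.Properties as ℕₚ
open import Data.Product using (∃; ∃₂; _×_; _,_; proj₁; proj₂)
open import Data.Sum using (inj₁; inj₂)
open import Data.Vec.Functional using (_++_; removeAt; last)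
import Data.Vec.Functional.Properties as VecF
import Data.Vec.Functional.Relation.Binary.Pointwise.Properties as Pointwise
open import Function using (_∘_; case_of_)
open import Relation.Binary using (Decidable)
open import Relation.Binary.Definitions using (tri<; tri≈; tri>)
open import Relation.Binary.PropositionalEquality as ≡ using (_≡_; _≢_)
open import Relation.Nullary using (¬_; Dec; yes; no; does)
open import Relation.Nullary.Decidable using (dec-true; dec-false)

module _ (F : FiniteField) where
  open FiniteField F hiding (zero)
  open FieldDefs F
  open import Algebra.Properties.Semiring.Sum semiring
    using ( sum; sum-cong-≋; ∑-distrib-+; ∑-comm; *-distribˡ-sum; *-distribʳ-sum
          ; sum-remove; sum-replicate-zero; sum-init-last)
  open import Algebra.Properties.Ring ring using (-1*x≈-x; -‿distribˡ-*; -‿distribʳ-*)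
  open import Algebra.Properties.Group +-group
    using (ε⁻¹≈ε; ⁻¹-injective; x∙y⁻¹≈ε⇒x≈y; x≈y⇒x∙y⁻¹≈ε; //-rightDividesˡ; identityʳ-unique)
  open import Data.Vec.Functional.Relation.Binary.Equality.Setoid setoid
    using (_≋_; ≋-refl; ≋-sym; ≋-trans; ≋-reflexive)
  open Algebra.Properties.CommutativeSemigroup +-commutativeSemigroup using (interchange; x∙yz≈xz∙y)
  module *-CS = Algebra.Properties.CommutativeSemigroup *-commutativeSemigroup
  open import Relation.Binary.Reasoning.Setoid setoid

  -- Finite fields

  index : Carrier → Fin size
  index x = proj₁ (enum-surj x)

  enum-index : ∀ x → enum (index x) ≈ x
  enum-index x = proj₂ (enum-surj x)

  index-injective : ∀ {x y} → index x ≡ index y → x ≈ y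
  index-injective {x} {y} i≡j = trans (sym (enum-index x)) (trans (reflexive (≡.cong enum i≡j)) (enum-index y))

  _≈?_ : Decidable _≈_
  x ≈? y with index x Fin.≟ index y
  ... | yes i≡j = yes (index-injective i≡j)
  ... | no i≢j  = no λ x≈y → i≢j (enum-inj _ _ (trans (enum-index x) (trans x≈y (sym (enum-index y)))))

  x*y≈0⇒x≈0 : ∀ {x y} → ¬ y ≈ 0# → x * y ≈ 0# → x ≈ 0#
  x*y≈0⇒x≈0 {x} {y} y≉0 xy≈0 with inverse y y≉0
  ... | y⁻¹ , yy⁻¹≈1 = begin
    x               ≈⟨ *-identityʳ x ⟨
    x * 1#          ≈⟨ *-congˡ yy⁻¹≈1 ⟨
    x * (y * y⁻¹)   ≈⟨ *-assoc x y y⁻¹ ⟨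
    (x * y) * y⁻¹   ≈⟨ *-congʳ xy≈0 ⟩
    0# * y⁻¹        ≈⟨ zeroˡ y⁻¹ ⟩
    0#              ∎

  -x≈0⇒x≈0 : ∀ {x} → - x ≈ 0# → x ≈ 0#
  -x≈0⇒x≈0 -x≈0 = ⁻¹-injective (trans -x≈0 (sym ε⁻¹≈ε))

  encode : ∀ {m} → Vect m → Fin (q ℕ.^ m)
  encode {zero}  v = Fin.zero
  encode {suc m} v = Fin.combine (index (v Fin.zero)) (encode (λ i → v (Fin.suc i)))

  encode-injective : ∀ {m} (v w : Vect m) → encode v ≡ encode w → v ≋ w
  encode-injective {suc m} v w eq = λ
    { Fin.zero    → index-injective (proj₁ heads-and-tails)
    ; (Fin.suc i) → encode-injective (λ i → v (Fin.suc i)) (λ i → w (Fin.suc i)) (proj₂ heads-and-tails) i }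
    where
    heads-and-tails : index (v Fin.zero) ≡ index (w Fin.zero)
                    × encode (λ i → v (Fin.suc i)) ≡ encode (λ i → w (Fin.suc i))
    heads-and-tails = Finₚ.combine-injective (index (v Fin.zero)) (encode (λ i → v (Fin.suc i)))
                                             (index (w Fin.zero)) (encode (λ i → w (Fin.suc i))) eq

  Vect-pigeonhole : ∀ {m n} → q ℕ.^ m ℕ.< n → (v : Fin n → Vect m) → ∃₂ λ i j → i Fin.< j × v i ≋ v j
  Vect-pigeonhole qᵐ<n v with Finₚ.pigeonhole qᵐ<n (encode ∘ v)
  ... | i , j , i<j , eq = i , j , i<j , encode-injective (v i) (v j) eq

  -- Finite sums

  sumF≡sum : ∀ {n} (f : Fin n → Carrier) → sumF f ≡ sum f
  sumF≡sum {zero}  f = ≡.refl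
  sumF≡sum {suc n} f = ≡.cong (f Fin.zero +_) (sumF≡sum (λ i → f (Fin.suc i)))

  sumF-cong : ∀ {n} {f g : Fin n → Carrier} → f ≋ g → sumF f ≈ sumF g
  sumF-cong {f = f} {g} f≋g = begin
    sumF f ≡⟨ sumF≡sum f ⟩ sum f ≈⟨ sum-cong-≋ f≋g ⟩ sum g ≡⟨ sumF≡sum g ⟨ sumF g ∎

  sumF-zero : ∀ {n} {f : Fin n → Carrier} → (∀ i → f i ≈ 0#) → sumF f ≈ 0#
  sumF-zero {n} {f} f≈0 = begin
    sumF f           ≈⟨ sumF-cong f≈0 ⟩
    sumF {n} (λ _ → 0#) ≡⟨ sumF≡sum {n} (λ _ → 0#) ⟩
    sum {n} (λ _ → 0#)   ≈⟨ sum-replicate-zero n ⟩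
    0#               ∎

  sumF-+ : ∀ {n} (f g : Fin n → Carrier) → sumF (λ i → f i + g i) ≈ sumF f + sumF g
  sumF-+ f g = begin
    sumF (λ i → f i + g i) ≡⟨ sumF≡sum (λ i → f i + g i) ⟩
    sum (λ i → f i + g i)  ≈⟨ ∑-distrib-+ f g ⟩
    sum f + sum g          ≡⟨ ≡.cong₂ _+_ (sumF≡sum f) (sumF≡sum g) ⟨
    sumF f + sumF g        ∎

  *-distribˡ-sumF : ∀ {n} x (f : Fin n → Carrier) → x * sumF f ≈ sumF (λ i → x * f i)
  *-distribˡ-sumF x f = begin
    x * sumF f             ≡⟨ ≡.cong (x *_) (sumF≡sum f) ⟩
    x * sum f              ≈⟨ *-distribˡ-sum x f ⟩
    sum (λ i → x * f i)    ≡⟨ sumF≡sum (λ i → x * f i) ⟨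
    sumF (λ i → x * f i)   ∎

  *-distribʳ-sumF : ∀ {n} x (f : Fin n → Carrier) → sumF f * x ≈ sumF (λ i → f i * x)
  *-distribʳ-sumF x f = begin
    sumF f * x             ≡⟨ ≡.cong (_* x) (sumF≡sum f) ⟩
    sum f * x              ≈⟨ *-distribʳ-sum x f ⟩
    sum (λ i → f i * x)    ≡⟨ sumF≡sum (λ i → f i * x) ⟨
    sumF (λ i → f i * x)   ∎

  -‿sumF : ∀ {n} (f : Fin n → Carrier) → - sumF f ≈ sumF (λ i → - f i)
  -‿sumF f = begin
    - sumF f                 ≈⟨ -1*x≈-x (sumF f) ⟨
    - 1# * sumF f            ≈⟨ *-distribˡ-sumF (- 1#) f ⟩
    sumF (λ i → - 1# * f i)  ≈⟨ sumF-cong (λ i → -1*x≈-x (f i)) ⟩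
    sumF (λ i → - f i)       ∎

  sumF-comm : ∀ {m n} (f : Fin m → Fin n → Carrier) →
              sumF (λ i → sumF (f i)) ≈ sumF (λ j → sumF (λ i → f i j))
  sumF-comm f = begin
    sumF (λ i → sumF (f i))          ≈⟨ sumF-cong (λ i → reflexive (sumF≡sum (f i))) ⟩
    sumF (λ i → sum (f i))           ≡⟨ sumF≡sum (λ i → sum (f i)) ⟩
    sum (λ i → sum (f i))            ≈⟨ ∑-comm f ⟩
    sum (λ j → sum (λ i → f i j))    ≡⟨ sumF≡sum (λ j → sum (λ i → f i j)) ⟨
    sumF (λ j → sum (λ i → f i j))   ≈⟨ sumF-cong (λ j → reflexive (sumF≡sum (λ i → f i j))) ⟨
    sumF (λ j → sumF (λ i → f i j))  ∎

  sumF-δ : ∀ {n} (f : Fin n → Carrier) i₀ → (∀ i → i ≢ i₀ → f i ≈ 0#) → sumF f ≈ f i₀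
  sumF-δ {suc n} f i₀ f≈0 = begin
    sumF f                         ≡⟨ sumF≡sum f ⟩
    sum f                          ≈⟨ sum-remove {i = i₀} f ⟩
    f i₀ + sum (removeAt f i₀)     ≡⟨ ≡.cong (f i₀ +_) (sumF≡sum (removeAt f i₀)) ⟨
    f i₀ + sumF (removeAt f i₀)    ≈⟨ +-congˡ (sumF-zero (λ j → f≈0 _ (Finₚ.punchInᵢ≢i i₀ j))) ⟩
    f i₀ + 0#                      ≈⟨ +-identityʳ (f i₀) ⟩
    f i₀                           ∎

  sumF-init-last : ∀ {n} (f : Fin (suc n) → Carrier) →
                   sumF f ≈ sumF (λ i → f (inject₁ i)) + f (fromℕ n)
  sumF-init-last f = begin
    sumF f                                 ≡⟨ sumF≡sum f ⟩
    sum f                                  ≈⟨ sum-init-last f ⟩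
    sum (λ i → f (inject₁ i)) + f (fromℕ _) ≡⟨ ≡.cong (_+ f (fromℕ _)) (sumF≡sum (λ i → f (inject₁ i))) ⟨
    sumF (λ i → f (inject₁ i)) + f (fromℕ _) ∎

  sumF-↑ : ∀ m {n} (f : Fin (m ℕ.+ n) → Carrier) →
           sumF f ≈ sumF (λ i → f (i ↑ˡ n)) + sumF (λ j → f (m ↑ʳ j))
  sumF-↑ zero    f = sym (+-identityˡ (sumF f))
  sumF-↑ (suc m) f = trans (+-congˡ (sumF-↑ m (λ i → f (Fin.suc i)))) (sym (+-assoc _ _ _))

  -- Row vectors and matrices

  0ᵛ : ∀ {n} → Vect n
  0ᵛ _ = 0#

  _+ᵛ_ : ∀ {n} → Vect n → Vect n → Vect n
  (u +ᵛ v) j = u j + v j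

  _-ᵛ_ : ∀ {n} → Vect n → Vect n → Vect n
  (u -ᵛ v) j = u j - v j

  _·ᵛ_ : ∀ {n} → Carrier → Vect n → Vect n
  (s ·ᵛ v) j = s * v j

  infixl 6 _+ᵛ_ _-ᵛ_
  infixl 7 _·ᵛ_ _⊗ᵥ_

  -ᵛ≋0ᵛ⇒≋ : ∀ {n} {u v : Vect n} → u -ᵛ v ≋ 0ᵛ → u ≋ v
  -ᵛ≋0ᵛ⇒≋ u-v≋0 j = x∙y⁻¹≈ε⇒x≈y _ _ (u-v≋0 j)

  ≋⇒-ᵛ≋0ᵛ : ∀ {n} {u v : Vect n} → u ≋ v → u -ᵛ v ≋ 0ᵛ
  ≋⇒-ᵛ≋0ᵛ u≋v j = x≈y⇒x∙y⁻¹≈ε (u≋v j)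

  ++≋0ᵛ⇒ : ∀ {m n} {u : Vect m} {w : Vect n} → u ++ w ≋ 0ᵛ → u ≋ 0ᵛ × w ≋ 0ᵛ
  ++≋0ᵛ⇒ {m} {n} {u} {w} u++w≋0 = Pointwise.++⁻ _≈_ u 0ᵛ (≋-trans u++w≋0 0ᵛ≋0ᵛ++0ᵛ)
    where
    0ᵛ≋0ᵛ++0ᵛ : 0ᵛ ≋ 0ᵛ {m} ++ 0ᵛ {n}
    0ᵛ≋0ᵛ++0ᵛ j with splitAt m j
    ... | inj₁ _ = refl
    ... | inj₂ _ = refl

  _⊗ᵥ_ : ∀ {m n} → Vect m → Mat m n → Vect n
  (c ⊗ᵥ V) j = sumF (λ i → c i * V i j)

  ⊗ᵥ-congˡ : ∀ {m n} (V : Mat m n) {c c′ : Vect m} → c ≋ c′ → c ⊗ᵥ V ≋ c′ ⊗ᵥ V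
  ⊗ᵥ-congˡ V c≋c′ j = sumF-cong (λ i → *-congʳ (c≋c′ i))

  ⊗ᵥ-zeroˡ : ∀ {m n} (V : Mat m n) → 0ᵛ ⊗ᵥ V ≋ 0ᵛ
  ⊗ᵥ-zeroˡ V j = sumF-zero (λ i → zeroˡ (V i j))

  ⊗ᵥ-zeroʳ : ∀ {m n} (c : Vect m) → c ⊗ᵥ zeroMat {m} {n} ≋ 0ᵛ
  ⊗ᵥ-zeroʳ c j = sumF-zero (λ i → zeroʳ (c i))

  ⊗ᵥ-distribʳ-+ᵛ : ∀ {m n} (V : Mat m n) (c c′ : Vect m) → (c +ᵛ c′) ⊗ᵥ V ≋ c ⊗ᵥ V +ᵛ c′ ⊗ᵥ V
  ⊗ᵥ-distribʳ-+ᵛ V c c′ j =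
    trans (sumF-cong (λ i → distribʳ (V i j) (c i) (c′ i))) (sumF-+ (λ i → c i * V i j) (λ i → c′ i * V i j))

  ⊗ᵥ-distribʳ--ᵛ : ∀ {m n} (V : Mat m n) (c c′ : Vect m) → (c -ᵛ c′) ⊗ᵥ V ≋ c ⊗ᵥ V -ᵛ c′ ⊗ᵥ V
  ⊗ᵥ-distribʳ--ᵛ V c c′ j = begin
    sumF (λ i → (c i - c′ i) * V i j)             ≈⟨ sumF-cong (λ i → distribʳ (V i j) (c i) (- c′ i)) ⟩
    sumF (λ i → c i * V i j + - c′ i * V i j)     ≈⟨ sumF-+ (λ i → c i * V i j) (λ i → - c′ i * V i j) ⟩
    (c ⊗ᵥ V) j + sumF (λ i → - c′ i * V i j)      ≈⟨ +-congˡ (sumF-cong (λ i → -‿distribˡ-* (c′ i) (V i j))) ⟨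
    (c ⊗ᵥ V) j + sumF (λ i → - (c′ i * V i j))    ≈⟨ +-congˡ (-‿sumF (λ i → c′ i * V i j)) ⟨
    (c ⊗ᵥ V) j - (c′ ⊗ᵥ V) j                      ∎

  ⊗ᵥ-·ᵛ : ∀ {m n} (V : Mat m n) s (c : Vect m) → (s ·ᵛ c) ⊗ᵥ V ≋ s ·ᵛ (c ⊗ᵥ V)
  ⊗ᵥ-·ᵛ V s c j = trans (sumF-cong (λ i → *-assoc s (c i) (V i j))) (sym (*-distribˡ-sumF s (λ i → c i * V i j)))

  ⊗ᵥ-assoc : ∀ {m n p} (c : Vect m) (A : Mat m n) (B : Mat n p) → c ⊗ᵥ (A ⊗ B) ≋ (c ⊗ᵥ A) ⊗ᵥ B
  ⊗ᵥ-assoc c A B j = begin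
    sumF (λ i → c i * sumF (λ l → A i l * B l j))    ≈⟨ sumF-cong (λ i → *-distribˡ-sumF (c i) (λ l → A i l * B l j)) ⟩
    sumF (λ i → sumF (λ l → c i * (A i l * B l j)))  ≈⟨ sumF-comm (λ i l → c i * (A i l * B l j)) ⟩
    sumF (λ l → sumF (λ i → c i * (A i l * B l j)))
      ≈⟨ sumF-cong (λ l → sumF-cong (λ i → *-assoc (c i) (A i l) (B l j))) ⟨
    sumF (λ l → sumF (λ i → c i * A i l * B l j))    ≈⟨ sumF-cong (λ l → *-distribʳ-sumF (B l j) (λ i → c i * A i l)) ⟨
    sumF (λ l → (c ⊗ᵥ A) l * B l j)                  ∎

  ⊗ᵥ-cancelʳ : ∀ {m n} {V : Mat m n} → FullRowRank V → ∀ {c c′} → c ⊗ᵥ V ≋ c′ ⊗ᵥ V → c ≋ c′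
  ⊗ᵥ-cancelʳ {V = V} full {c} {c′} cV≋c′V =
    -ᵛ≋0ᵛ⇒≋ (full (c -ᵛ c′) (≋-trans (⊗ᵥ-distribʳ--ᵛ V c c′) (≋⇒-ᵛ≋0ᵛ cV≋c′V)))

  if-yes : ∀ {P A : Set} (p? : Dec P) {x y : A} → P → (if does p? then x else y) ≡ x
  if-yes p? {x} {y} p = ≡.cong (λ b → if b then x else y) (dec-true p? p)

  if-no : ∀ {P A : Set} (p? : Dec P) {x y : A} → ¬ P → (if does p? then x else y) ≡ y
  if-no p? {x} {y} ¬p = ≡.cong (λ b → if b then x else y) (dec-false p? ¬p)

  ⊗ᵥ-identityʳ : ∀ {n} (c : Vect n) → c ⊗ᵥ idMat ≋ c
  ⊗ᵥ-identityʳ c j = begin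
    sumF (λ i → c i * idMat i j)  ≈⟨ sumF-δ (λ i → c i * idMat i j) j off-diagonal ⟩
    c j * idMat j j               ≡⟨ ≡.cong (c j *_) (if-yes (toℕ j ℕ.≟ toℕ j) ≡.refl) ⟩
    c j * 1#                      ≈⟨ *-identityʳ (c j) ⟩
    c j                           ∎
    where
    off-diagonal : ∀ i → i ≢ j → c i * idMat i j ≈ 0#
    off-diagonal i i≢j = trans (*-congˡ (reflexive (if-no (toℕ i ℕ.≟ toℕ j) (i≢j ∘ Finₚ.toℕ-injective)))) (zeroʳ (c i))

  ⊗ᵥ-∣∣ : ∀ {m n₁ n₂} (c : Vect m) (A : Mat m n₁) (B : Mat m n₂) →
          c ⊗ᵥ (A ∣∣ B) ≋ (c ⊗ᵥ A) ++ (c ⊗ᵥ B)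
  ⊗ᵥ-∣∣ {n₁ = n₁} c A B j with splitAt n₁ j
  ... | inj₁ _ = refl
  ... | inj₂ _ = refl

  blockDiag-↑ˡ : ∀ {n₁ n₂} (A : Mat n₁ n₁) (B : Mat n₂ n₂) i j →
                 blockDiag A B (i ↑ˡ n₂) j ≡ (A ∣∣ zeroMat) i j
  blockDiag-↑ˡ {n₁} {n₂} A B i j rewrite Finₚ.splitAt-↑ˡ n₁ i n₂ with splitAt n₁ j
  ... | inj₁ _ = ≡.refl
  ... | inj₂ _ = ≡.refl

  blockDiag-↑ʳ : ∀ {n₁ n₂} (A : Mat n₁ n₁) (B : Mat n₂ n₂) i j →
                 blockDiag A B (n₁ ↑ʳ i) j ≡ (zeroMat ∣∣ B) i j
  blockDiag-↑ʳ {n₁} {n₂} A B i j rewrite Finₚ.splitAt-↑ʳ n₁ n₂ i with splitAt n₁ j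
  ... | inj₁ _ = ≡.refl
  ... | inj₂ _ = ≡.refl

  ++-+ᵛ-0ᵛ : ∀ {n₁ n₂} (u : Vect n₁) (w : Vect n₂) → (u ++ 0ᵛ) +ᵛ (0ᵛ ++ w) ≋ u ++ w
  ++-+ᵛ-0ᵛ {n₁} u w j with splitAt n₁ j
  ... | inj₁ i = +-identityʳ (u i)
  ... | inj₂ i = +-identityˡ (w i)

  ⊗ᵥ-blockDiag : ∀ {n₁ n₂} (u : Vect n₁) (w : Vect n₂) (A : Mat n₁ n₁) (B : Mat n₂ n₂) →
                 (u ++ w) ⊗ᵥ blockDiag A B ≋ (u ⊗ᵥ A) ++ (w ⊗ᵥ B)
  ⊗ᵥ-blockDiag {n₁} {n₂} u w A B j = begin
    ((u ++ w) ⊗ᵥ blockDiag A B) j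
      ≈⟨ sumF-↑ n₁ (λ i → (u ++ w) i * blockDiag A B i j) ⟩
    sumF (λ i → (u ++ w) (i ↑ˡ n₂) * blockDiag A B (i ↑ˡ n₂) j)
      + sumF (λ i → (u ++ w) (n₁ ↑ʳ i) * blockDiag A B (n₁ ↑ʳ i) j)
      ≈⟨ +-cong (sumF-cong (λ i → reflexive (≡.cong₂ _*_ (VecF.lookup-++ˡ u w i) (blockDiag-↑ˡ A B i j))))
                (sumF-cong (λ i → reflexive (≡.cong₂ _*_ (VecF.lookup-++ʳ u w i) (blockDiag-↑ʳ A B i j)))) ⟩
    (u ⊗ᵥ (A ∣∣ zeroMat)) j + (w ⊗ᵥ (zeroMat ∣∣ B)) j
      ≈⟨ +-cong (≋-trans (⊗ᵥ-∣∣ u A zeroMat) (Pointwise.++⁺ _≈_ {n₁} {xs = u ⊗ᵥ A} ≋-refl (⊗ᵥ-zeroʳ u)) j)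
                (≋-trans (⊗ᵥ-∣∣ w zeroMat B) (Pointwise.++⁺ _≈_ {n₁} {xs′ = w ⊗ᵥ B} (⊗ᵥ-zeroʳ w) ≋-refl) j) ⟩
    ((u ⊗ᵥ A) ++ 0ᵛ) j + (0ᵛ ++ (w ⊗ᵥ B)) j
      ≈⟨ ++-+ᵛ-0ᵛ (u ⊗ᵥ A) (w ⊗ᵥ B) j ⟩
    ((u ⊗ᵥ A) ++ (w ⊗ᵥ B)) j ∎

  ⊗ᵥ-^ᴹ : ∀ {n} (A : Mat n n) e (v : Vect n) → v ⊗ᵥ (A ^ᴹ e) ≋ fold v (_⊗ᵥ A) e
  ⊗ᵥ-^ᴹ A zero    v = ⊗ᵥ-identityʳ v
  ⊗ᵥ-^ᴹ A (suc e) v = ≋-trans (⊗ᵥ-assoc v (A ^ᴹ e) A) (⊗ᵥ-congˡ A (⊗ᵥ-^ᴹ A e v))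

  fold-⊗ᵥ-cong : ∀ {n} (A : Mat n n) e {v w : Vect n} → v ≋ w → fold v (_⊗ᵥ A) e ≋ fold w (_⊗ᵥ A) e
  fold-⊗ᵥ-cong A zero    v≋w = v≋w
  fold-⊗ᵥ-cong A (suc e) v≋w = ⊗ᵥ-congˡ A (fold-⊗ᵥ-cong A e v≋w)

  fold-⊗ᵥ-0ᵛ : ∀ {n} (A : Mat n n) e → fold 0ᵛ (_⊗ᵥ A) e ≋ 0ᵛ
  fold-⊗ᵥ-0ᵛ A zero    = ≋-refl
  fold-⊗ᵥ-0ᵛ A (suc e) = ≋-trans (⊗ᵥ-congˡ A (fold-⊗ᵥ-0ᵛ A e)) (⊗ᵥ-zeroˡ A)

  fold-⊗ᵥ--ᵛ : ∀ {n} (A : Mat n n) e (v w : Vect n) →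
               fold (v -ᵛ w) (_⊗ᵥ A) e ≋ fold v (_⊗ᵥ A) e -ᵛ fold w (_⊗ᵥ A) e
  fold-⊗ᵥ--ᵛ A zero    v w = ≋-refl
  fold-⊗ᵥ--ᵛ A (suc e) v w = ≋-trans (⊗ᵥ-congˡ A (fold-⊗ᵥ--ᵛ A e v w)) (⊗ᵥ-distribʳ--ᵛ A _ _)

  fold-⊗ᵥ-blockDiag-idMat : ∀ {n₁ n₂} (B : Mat n₂ n₂) e (u : Vect n₁) (w : Vect n₂) →
                            fold (u ++ w) (_⊗ᵥ blockDiag idMat B) e ≋ u ++ fold w (_⊗ᵥ B) e
  fold-⊗ᵥ-blockDiag-idMat B zero    u w = ≋-refl
  fold-⊗ᵥ-blockDiag-idMat B (suc e) u w =
    ≋-trans (⊗ᵥ-congˡ (blockDiag idMat B) (fold-⊗ᵥ-blockDiag-idMat B e u w))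
            (≋-trans (⊗ᵥ-blockDiag u (fold w (_⊗ᵥ B) e) idMat B) (Pointwise.++⁺ _≈_ (⊗ᵥ-identityʳ u) ≋-refl))

  fold-comm : ∀ {A : Set} (s : A → A) x i j → fold (fold x s i) s j ≡ fold (fold x s j) s i
  fold-comm s x i j = ≡.trans (≡.sym (fold-+ x s j)) (≡.trans (≡.cong (fold x s) (ℕₚ.+-comm j i)) (fold-+ x s i))

  -- Subspaces

  ≐-refl : ∀ {n} {W : Gen n} → W ≐ W
  ≐-refl v = (λ v∈W → v∈W) , (λ v∈W → v∈W)

  ≐-sym : ∀ {n} {W W′ : Gen n} → W ≐ W′ → W′ ≐ W
  ≐-sym W≐W′ v = proj₂ (W≐W′ v) , proj₁ (W≐W′ v)

  ≐-trans : ∀ {n} {W W′ W″ : Gen n} → W ≐ W′ → W′ ≐ W″ → W ≐ W″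
  ≐-trans W≐W′ W′≐W″ v = (λ v∈W → proj₁ (W′≐W″ v) (proj₁ (W≐W′ v) v∈W))
                       , (λ v∈W″ → proj₂ (W≐W′ v) (proj₂ (W′≐W″ v) v∈W″))

  rowsp-≐ : ∀ {m n} (A B : Mat m n) → (∀ c → c ⊗ᵥ A ≋ c ⊗ᵥ B) → rowsp A ≐ rowsp B
  rowsp-≐ A B cA≋cB v = (λ { (c , v≋cA) → c , ≋-trans v≋cA (cA≋cB c) })
                      , (λ { (c , v≋cB) → c , ≋-trans v≋cB (≋-sym (cA≋cB c)) })

  TrivialIntersection-sym : ∀ {n} {W W′ : Gen n} → TrivialIntersection W W′ → TrivialIntersection W′ W
  TrivialIntersection-sym W∩W′≡0 v v∈W′ v∈W = W∩W′≡0 v v∈W v∈W′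

  TrivialIntersection-resp-≐ : ∀ {n} {W W′ X X′ : Gen n} → W ≐ X → W′ ≐ X′ →
                               TrivialIntersection X X′ → TrivialIntersection W W′
  TrivialIntersection-resp-≐ W≐X W′≐X′ X∩X′≡0 v v∈W v∈W′ =
    X∩X′≡0 v (proj₁ (W≐X v) v∈W) (proj₁ (W′≐X′ v) v∈W′)

  -- Polynomials

  coeff : Poly → ℕ → Carrier
  coeff []      _       = 0#
  coeff (c ∷ p) zero    = c
  coeff (c ∷ p) (suc i) = coeff p i

  -- A record, so that p and r can be inferred from a proof.
  infix 4 _≈ᶜ_
  record _≈ᶜ_ (p r : Poly) : Set where
    constructor mk≈ᶜ
    field coeff-≈ : ∀ i → coeff p i ≈ coeff r i
  open _≈ᶜ_

  ≈ᶜ-refl : ∀ {p} → p ≈ᶜ p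
  ≈ᶜ-refl = mk≈ᶜ λ _ → refl

  ≈ᶜ-sym : ∀ {p r} → p ≈ᶜ r → r ≈ᶜ p
  ≈ᶜ-sym p≈r = mk≈ᶜ λ i → sym (coeff-≈ p≈r i)

  ≈ᶜ-trans : ∀ {p r s} → p ≈ᶜ r → r ≈ᶜ s → p ≈ᶜ s
  ≈ᶜ-trans p≈r r≈s = mk≈ᶜ λ i → trans (coeff-≈ p≈r i) (coeff-≈ r≈s i)

  ≈ᶜ-reflexive : ∀ {p r} → p ≡ r → p ≈ᶜ r
  ≈ᶜ-reflexive ≡.refl = ≈ᶜ-refl

  ∷-cong : ∀ {c d p r} → c ≈ d → p ≈ᶜ r → c ∷ p ≈ᶜ d ∷ r
  ∷-cong c≈d p≈r = mk≈ᶜ λ { zero → c≈d ; (suc i) → coeff-≈ p≈r i }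

  ≈ᶜ⇒≈ₚ : ∀ p r → p ≈ᶜ r → p ≈ₚ r
  ≈ᶜ⇒≈ₚ []      []      _  = _
  ≈ᶜ⇒≈ₚ []      (d ∷ r) e  = sym (coeff-≈ e zero) , ≈ᶜ⇒≈ₚ [] r (mk≈ᶜ λ i → coeff-≈ e (suc i))
  ≈ᶜ⇒≈ₚ (c ∷ p) []      e  = coeff-≈ e zero , ≈ᶜ⇒≈ₚ p [] (mk≈ᶜ λ i → coeff-≈ e (suc i))
  ≈ᶜ⇒≈ₚ (c ∷ p) (d ∷ r) e  = coeff-≈ e zero , ≈ᶜ⇒≈ₚ p r (mk≈ᶜ λ i → coeff-≈ e (suc i))

  ≈ₚ⇒≈ᶜ : ∀ p r → p ≈ₚ r → p ≈ᶜ r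
  ≈ₚ⇒≈ᶜ []      []      _         = ≈ᶜ-refl
  ≈ₚ⇒≈ᶜ []      (d ∷ r) (d≈0 , e) = mk≈ᶜ λ { zero → sym d≈0 ; (suc i) → coeff-≈ (≈ₚ⇒≈ᶜ [] r e) i }
  ≈ₚ⇒≈ᶜ (c ∷ p) []      (c≈0 , e) = mk≈ᶜ λ { zero → c≈0 ; (suc i) → coeff-≈ (≈ₚ⇒≈ᶜ p [] e) i }
  ≈ₚ⇒≈ᶜ (c ∷ p) (d ∷ r) (c≈d , e) = ∷-cong c≈d (≈ₚ⇒≈ᶜ p r e)

  coeff-+ₚ : ∀ p r i → coeff (p +ₚ r) i ≈ coeff p i + coeff r i
  coeff-+ₚ []      r       i       = sym (+-identityˡ _)
  coeff-+ₚ (c ∷ p) []      i       = sym (+-identityʳ _)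
  coeff-+ₚ (c ∷ p) (d ∷ r) zero    = refl
  coeff-+ₚ (c ∷ p) (d ∷ r) (suc i) = coeff-+ₚ p r i

  coeff-scaleₚ : ∀ c p i → coeff (scaleₚ c p) i ≈ c * coeff p i
  coeff-scaleₚ c []      i       = sym (zeroʳ c)
  coeff-scaleₚ c (d ∷ p) zero    = refl
  coeff-scaleₚ c (d ∷ p) (suc i) = coeff-scaleₚ c p i

  +ₚ-cong : ∀ {p p′ r r′} → p ≈ᶜ p′ → r ≈ᶜ r′ → p +ₚ r ≈ᶜ p′ +ₚ r′
  +ₚ-cong {p} {p′} {r} {r′} p≈p′ r≈r′ = mk≈ᶜ λ i → begin
    coeff (p +ₚ r) i        ≈⟨ coeff-+ₚ p r i ⟩
    coeff p i + coeff r i   ≈⟨ +-cong (coeff-≈ p≈p′ i) (coeff-≈ r≈r′ i) ⟩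
    coeff p′ i + coeff r′ i ≈⟨ coeff-+ₚ p′ r′ i ⟨
    coeff (p′ +ₚ r′) i      ∎

  +ₚ-interchange : ∀ p r s t → (p +ₚ r) +ₚ (s +ₚ t) ≈ᶜ (p +ₚ s) +ₚ (r +ₚ t)
  +ₚ-interchange p r s t = mk≈ᶜ λ i → begin
    coeff ((p +ₚ r) +ₚ (s +ₚ t)) i
      ≈⟨ trans (coeff-+ₚ (p +ₚ r) (s +ₚ t) i) (+-cong (coeff-+ₚ p r i) (coeff-+ₚ s t i)) ⟩
    (coeff p i + coeff r i) + (coeff s i + coeff t i)
      ≈⟨ interchange (coeff p i) (coeff r i) (coeff s i) (coeff t i) ⟩
    (coeff p i + coeff s i) + (coeff r i + coeff t i)
      ≈⟨ trans (coeff-+ₚ (p +ₚ s) (r +ₚ t) i) (+-cong (coeff-+ₚ p s i) (coeff-+ₚ r t i)) ⟨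
    coeff ((p +ₚ s) +ₚ (r +ₚ t)) i ∎

  +ₚ-rotate : ∀ p r s → p +ₚ (r +ₚ s) ≈ᶜ (p +ₚ s) +ₚ r
  +ₚ-rotate p r s = mk≈ᶜ λ i → begin
    coeff (p +ₚ (r +ₚ s)) i                 ≈⟨ trans (coeff-+ₚ p (r +ₚ s) i) (+-congˡ (coeff-+ₚ r s i)) ⟩
    coeff p i + (coeff r i + coeff s i)     ≈⟨ x∙yz≈xz∙y (coeff p i) (coeff r i) (coeff s i) ⟩
    (coeff p i + coeff s i) + coeff r i     ≈⟨ trans (coeff-+ₚ (p +ₚ s) r i) (+-congʳ (coeff-+ₚ p s i)) ⟨
    coeff ((p +ₚ s) +ₚ r) i                 ∎

  +ₚ-assoc : ∀ p r s → (p +ₚ r) +ₚ s ≈ᶜ p +ₚ (r +ₚ s)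
  +ₚ-assoc p r s = mk≈ᶜ λ i → begin
    coeff ((p +ₚ r) +ₚ s) i              ≈⟨ trans (coeff-+ₚ (p +ₚ r) s i) (+-congʳ (coeff-+ₚ p r i)) ⟩
    (coeff p i + coeff r i) + coeff s i  ≈⟨ +-assoc (coeff p i) (coeff r i) (coeff s i) ⟩
    coeff p i + (coeff r i + coeff s i)  ≈⟨ trans (coeff-+ₚ p (r +ₚ s) i) (+-congˡ (coeff-+ₚ r s i)) ⟨
    coeff (p +ₚ (r +ₚ s)) i              ∎

  +ₚ-identityʳ : ∀ p → p +ₚ [] ≡ p
  +ₚ-identityʳ []      = ≡.refl
  +ₚ-identityʳ (c ∷ p) = ≡.refl

  scaleₚ-distrib-+ₚ : ∀ c p r → scaleₚ c (p +ₚ r) ≈ᶜ scaleₚ c p +ₚ scaleₚ c r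
  scaleₚ-distrib-+ₚ c p r = mk≈ᶜ λ i → begin
    coeff (scaleₚ c (p +ₚ r)) i                 ≈⟨ trans (coeff-scaleₚ c (p +ₚ r) i) (*-congˡ (coeff-+ₚ p r i)) ⟩
    c * (coeff p i + coeff r i)                 ≈⟨ distribˡ c (coeff p i) (coeff r i) ⟩
    c * coeff p i + c * coeff r i               ≈⟨ trans (coeff-+ₚ (scaleₚ c p) (scaleₚ c r) i)
                                                         (+-cong (coeff-scaleₚ c p i) (coeff-scaleₚ c r i)) ⟨
    coeff (scaleₚ c p +ₚ scaleₚ c r) i          ∎

  *ₚ-zeroʳ : ∀ p → p *ₚ [] ≈ᶜ []
  *ₚ-zeroʳ []      = ≈ᶜ-refl
  *ₚ-zeroʳ (c ∷ p) = mk≈ᶜ λ { zero → refl ; (suc i) → coeff-≈ (*ₚ-zeroʳ p) i }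

  *ₚ-shiftʳ : ∀ p r → p *ₚ (0# ∷ r) ≈ᶜ 0# ∷ (p *ₚ r)
  *ₚ-shiftʳ []      r = mk≈ᶜ λ { zero → refl ; (suc i) → refl }
  *ₚ-shiftʳ (c ∷ p) r = ∷-cong (trans (+-identityʳ _) (zeroʳ c)) (+ₚ-cong (≈ᶜ-refl {scaleₚ c r}) (*ₚ-shiftʳ p r))

  *ₚ-constʳ : ∀ p t → p *ₚ (t ∷ []) ≈ᶜ scaleₚ t p
  *ₚ-constʳ []      t = ≈ᶜ-refl
  *ₚ-constʳ (c ∷ p) t = ∷-cong (trans (+-identityʳ _) (*-comm c t)) (*ₚ-constʳ p t)

  *ₚ-distribˡ-+ₚ : ∀ p r s → p *ₚ (r +ₚ s) ≈ᶜ (p *ₚ r) +ₚ (p *ₚ s)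
  *ₚ-distribˡ-+ₚ []      r s = ≈ᶜ-refl
  *ₚ-distribˡ-+ₚ (c ∷ p) r s = ≈ᶜ-trans
    (+ₚ-cong (scaleₚ-distrib-+ₚ c r s) (∷-cong (sym (+-identityˡ 0#)) (*ₚ-distribˡ-+ₚ p r s)))
    (+ₚ-interchange (scaleₚ c r) (scaleₚ c s) (0# ∷ (p *ₚ r)) (0# ∷ (p *ₚ s)))

  toPoly : ∀ {m} → Vect m → Poly
  toPoly {zero}  v = []
  toPoly {suc m} v = v Fin.zero ∷ toPoly (λ i → v (Fin.suc i))

  toPoly-cong : ∀ {m} {v w : Vect m} → v ≋ w → toPoly v ≈ᶜ toPoly w
  toPoly-cong {zero}  v≋w = ≈ᶜ-refl
  toPoly-cong {suc m} v≋w = ∷-cong (v≋w Fin.zero) (toPoly-cong (λ i → v≋w (Fin.suc i)))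

  toPoly-0ᵛ : ∀ {m} → toPoly {m} 0ᵛ ≈ᶜ []
  toPoly-0ᵛ {zero}  = ≈ᶜ-refl
  toPoly-0ᵛ {suc m} = mk≈ᶜ λ { zero → refl ; (suc i) → coeff-≈ (toPoly-0ᵛ {m}) i }

  length-toPoly : ∀ {m} (v : Vect m) → length (toPoly v) ≡ m
  length-toPoly {zero}  v = ≡.refl
  length-toPoly {suc m} v = ≡.cong suc (length-toPoly (λ i → v (Fin.suc i)))

  coeff-toPoly : ∀ {m} (v : Vect m) j → coeff (toPoly v) (toℕ j) ≡ v j
  coeff-toPoly v Fin.zero    = ≡.refl
  coeff-toPoly v (Fin.suc j) = coeff-toPoly (λ i → v (Fin.suc i)) j

  coeff-beyond-length : ∀ p i → length p ℕ.≤ i → coeff p i ≡ 0#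
  coeff-beyond-length []      i       _            = ≡.refl
  coeff-beyond-length (c ∷ p) (suc i) (ℕ.s≤s p≤i) = coeff-beyond-length p i p≤i

  toPoly-init-last : ∀ {m} (v : Vect (suc m)) → toPoly v ≡ toPoly (λ i → v (inject₁ i)) ++ₗ (last v ∷ [])
  toPoly-init-last {zero}  v = ≡.refl
  toPoly-init-last {suc m} v = ≡.cong (v Fin.zero ∷_) (toPoly-init-last (λ i → v (Fin.suc i)))

  toPoly-+ₚ-scaleₚ-monicPoly : ∀ {m} (w b : Vect m) t →
    toPoly (λ j → w j - t * b j) +ₚ scaleₚ t (monicPoly b) ≈ᶜ toPoly w ++ₗ (t ∷ [])
  toPoly-+ₚ-scaleₚ-monicPoly {zero}  w b t = ∷-cong (*-identityʳ t) ≈ᶜ-refl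
  toPoly-+ₚ-scaleₚ-monicPoly {suc m} w b t =
    ∷-cong (//-rightDividesˡ (t * b Fin.zero) (w Fin.zero))
           (toPoly-+ₚ-scaleₚ-monicPoly (λ i → w (Fin.suc i)) (λ i → b (Fin.suc i)) t)

  module Companion {k : ℕ} (a : Vect (suc k)) where

    M : Mat (suc k) (suc k)
    M = companion a

    shift : Vect (suc k) → Vect (suc k)
    shift y Fin.zero    = 0#
    shift y (Fin.suc j) = y (inject₁ j)

    companion-last : ∀ j → M (fromℕ k) j ≡ - a j
    companion-last j = if-yes (toℕ (fromℕ k) ℕ.≟ k) (Finₚ.toℕ-fromℕ k)

    companion-inject₁ : ∀ i j → M (inject₁ i) j ≡ (if does (toℕ j ℕ.≟ suc (toℕ (inject₁ i))) then 1# else 0#)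
    companion-inject₁ i j = if-no (toℕ (inject₁ i) ℕ.≟ k) (Finₚ.toℕ-inject₁-≢ i ∘ ≡.sym)

    companion-inject₁-zero : ∀ i → M (inject₁ i) Fin.zero ≡ 0#
    companion-inject₁-zero i = companion-inject₁ i Fin.zero

    companion-superdiagonal : ∀ j → M (inject₁ j) (Fin.suc j) ≡ 1#
    companion-superdiagonal j = ≡.trans (companion-inject₁ j (Fin.suc j))
      (if-yes (suc (toℕ j) ℕ.≟ suc (toℕ (inject₁ j))) (≡.cong suc (≡.sym (Finₚ.toℕ-inject₁ j))))

    companion-off-superdiagonal : ∀ i j → i ≢ j → M (inject₁ i) (Fin.suc j) ≡ 0#
    companion-off-superdiagonal i j i≢j = ≡.trans (companion-inject₁ i (Fin.suc j))
      (if-no (suc (toℕ j) ℕ.≟ suc (toℕ (inject₁ i)))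
             (λ j+1≡i+1 → i≢j (Finₚ.toℕ-injective
                (≡.trans (≡.sym (Finₚ.toℕ-inject₁ i)) (≡.sym (ℕₚ.suc-injective j+1≡i+1))))))

    ⊗ᵥ-companion : ∀ y j → (y ⊗ᵥ M) j ≈ shift y j - last y * a j
    ⊗ᵥ-companion y j = begin
      (y ⊗ᵥ M) j
        ≈⟨ sumF-init-last (λ i → y i * M i j) ⟩
      sumF (λ i → y (inject₁ i) * M (inject₁ i) j) + last y * M (fromℕ k) j
        ≈⟨ +-cong (shifted j) (reflexive (≡.cong (last y *_) (companion-last j))) ⟩
      shift y j + last y * - a j
        ≈⟨ +-congˡ (-‿distribʳ-* (last y) (a j)) ⟨
      shift y j - last y * a j ∎
      where
      shifted : ∀ j → sumF (λ i → y (inject₁ i) * M (inject₁ i) j) ≈ shift y j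
      shifted Fin.zero    = sumF-zero λ i → trans (*-congˡ (reflexive (companion-inject₁-zero i))) (zeroʳ _)
      shifted (Fin.suc j) = begin
        sumF (λ i → y (inject₁ i) * M (inject₁ i) (Fin.suc j))
          ≈⟨ sumF-δ _ j (λ i i≢j → trans (*-congˡ (reflexive (companion-off-superdiagonal i j i≢j))) (zeroʳ _)) ⟩
        y (inject₁ j) * M (inject₁ j) (Fin.suc j)
          ≈⟨ trans (*-congˡ (reflexive (companion-superdiagonal j))) (*-identityʳ _) ⟩
        y (inject₁ j) ∎

    ⊗ᵥ-companion≋0⇒last≈0 : ¬ a Fin.zero ≈ 0# → ∀ {y} → y ⊗ᵥ M ≋ 0ᵛ → last y ≈ 0#
    ⊗ᵥ-companion≋0⇒last≈0 a₀≉0 {y} yM≈0 = x*y≈0⇒x≈0 a₀≉0 (-x≈0⇒x≈0 (begin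
      - (last y * a Fin.zero)   ≈⟨ +-identityˡ _ ⟨
      0# - last y * a Fin.zero  ≈⟨ ⊗ᵥ-companion y Fin.zero ⟨
      (y ⊗ᵥ M) Fin.zero         ≈⟨ yM≈0 Fin.zero ⟩
      0#                        ∎))

    ⊗ᵥ-companion-injective : ¬ a Fin.zero ≈ 0# → ∀ {y} → y ⊗ᵥ M ≋ 0ᵛ → y ≋ 0ᵛ
    ⊗ᵥ-companion-injective a₀≉0 {y} yM≈0 i with Top.view i
    ... | Top.‵fromℕ     = ⊗ᵥ-companion≋0⇒last≈0 a₀≉0 {y} yM≈0
    ... | Top.‵inject₁ j = begin
      y (inject₁ j)                 ≈⟨ +-identityʳ _ ⟨
      y (inject₁ j) + 0#            ≈⟨ +-congˡ (trans (-‿cong (trans (*-congʳ last≈0) (zeroˡ _))) ε⁻¹≈ε) ⟨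
      y (inject₁ j) - last y * a _  ≈⟨ ⊗ᵥ-companion y (Fin.suc j) ⟨
      (y ⊗ᵥ M) (Fin.suc j)          ≈⟨ yM≈0 (Fin.suc j) ⟩
      0#                            ∎
      where
      last≈0 : last y ≈ 0#
      last≈0 = ⊗ᵥ-companion≋0⇒last≈0 a₀≉0 {y} yM≈0

    fold-⊗ᵥ-companion-cancel : ¬ a Fin.zero ≈ 0# → ∀ e {y z} → fold y (_⊗ᵥ M) e ≋ fold z (_⊗ᵥ M) e → y ≋ z
    fold-⊗ᵥ-companion-cancel a₀≉0 e {y} {z} yMᵉ≋zMᵉ =
      -ᵛ≋0ᵛ⇒≋ (fold-injective e (≋-trans (fold-⊗ᵥ--ᵛ M e y z) (≋⇒-ᵛ≋0ᵛ yMᵉ≋zMᵉ)))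
      where
      fold-injective : ∀ e {x} → fold x (_⊗ᵥ M) e ≋ 0ᵛ → x ≋ 0ᵛ
      fold-injective zero    xMᵉ≋0 = xMᵉ≋0
      fold-injective (suc e) xMᵉ≋0 = fold-injective e (⊗ᵥ-companion-injective a₀≉0 xMᵉ≋0)

    -- v ⊗ᵥ[ p ] is v · p(M).
    infixl 8 _⊗ᵥ[_]
    _⊗ᵥ[_] : Vect (suc k) → Poly → Vect (suc k)
    v ⊗ᵥ[ [] ]    = 0ᵛ
    v ⊗ᵥ[ c ∷ p ] = c ·ᵛ v +ᵛ (v ⊗ᵥ M) ⊗ᵥ[ p ]

    ⊗ᵥ[]-congˡ : ∀ p {v w} → v ≋ w → v ⊗ᵥ[ p ] ≋ w ⊗ᵥ[ p ]
    ⊗ᵥ[]-congˡ []      v≋w j = refl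
    ⊗ᵥ[]-congˡ (c ∷ p) v≋w j = +-cong (*-congˡ (v≋w j)) (⊗ᵥ[]-congˡ p (⊗ᵥ-congˡ M v≋w) j)

    ⊗ᵥ[]-zeroˡ : ∀ p → 0ᵛ ⊗ᵥ[ p ] ≋ 0ᵛ
    ⊗ᵥ[]-zeroˡ []      j = refl
    ⊗ᵥ[]-zeroˡ (c ∷ p) j =
      trans (+-cong (zeroʳ c) (≋-trans (⊗ᵥ[]-congˡ p (⊗ᵥ-zeroˡ M)) (⊗ᵥ[]-zeroˡ p) j)) (+-identityˡ 0#)

    ⊗ᵥ[]-distribʳ-+ᵛ : ∀ p v w → (v +ᵛ w) ⊗ᵥ[ p ] ≋ v ⊗ᵥ[ p ] +ᵛ w ⊗ᵥ[ p ]
    ⊗ᵥ[]-distribʳ-+ᵛ []      v w j = sym (+-identityˡ 0#)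
    ⊗ᵥ[]-distribʳ-+ᵛ (c ∷ p) v w j = begin
      c * (v j + w j) + (((v +ᵛ w) ⊗ᵥ M) ⊗ᵥ[ p ]) j
        ≈⟨ +-cong (distribˡ c (v j) (w j))
                  (≋-trans (⊗ᵥ[]-congˡ p (⊗ᵥ-distribʳ-+ᵛ M v w)) (⊗ᵥ[]-distribʳ-+ᵛ p (v ⊗ᵥ M) (w ⊗ᵥ M)) j) ⟩
      (c * v j + c * w j) + (((v ⊗ᵥ M) ⊗ᵥ[ p ]) j + ((w ⊗ᵥ M) ⊗ᵥ[ p ]) j)
        ≈⟨ interchange (c * v j) (c * w j) _ _ ⟩
      (v ⊗ᵥ[ c ∷ p ] +ᵛ w ⊗ᵥ[ c ∷ p ]) j ∎

    ⊗ᵥ[]-·ᵛ : ∀ p s v → (s ·ᵛ v) ⊗ᵥ[ p ] ≋ s ·ᵛ v ⊗ᵥ[ p ]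
    ⊗ᵥ[]-·ᵛ []      s v j = sym (zeroʳ s)
    ⊗ᵥ[]-·ᵛ (c ∷ p) s v j = begin
      c * (s * v j) + (((s ·ᵛ v) ⊗ᵥ M) ⊗ᵥ[ p ]) j
        ≈⟨ +-cong (*-CS.x∙yz≈y∙xz c s (v j))
                  (≋-trans (⊗ᵥ[]-congˡ p (⊗ᵥ-·ᵛ M s v)) (⊗ᵥ[]-·ᵛ p s (v ⊗ᵥ M)) j) ⟩
      s * (c * v j) + s * ((v ⊗ᵥ M) ⊗ᵥ[ p ]) j
        ≈⟨ distribˡ s _ _ ⟨
      s * (v ⊗ᵥ[ c ∷ p ]) j ∎

    ⊗ᵥ[]-⊗ᵥ-comm : ∀ p v → (v ⊗ᵥ M) ⊗ᵥ[ p ] ≋ v ⊗ᵥ[ p ] ⊗ᵥ M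
    ⊗ᵥ[]-⊗ᵥ-comm []      v = ≋-sym (⊗ᵥ-zeroˡ M)
    ⊗ᵥ[]-⊗ᵥ-comm (c ∷ p) v j = begin
      c * (v ⊗ᵥ M) j + ((v ⊗ᵥ M ⊗ᵥ M) ⊗ᵥ[ p ]) j
        ≈⟨ +-cong (⊗ᵥ-·ᵛ M c v j) (sym (⊗ᵥ[]-⊗ᵥ-comm p (v ⊗ᵥ M) j)) ⟨
      (c ·ᵛ v ⊗ᵥ M) j + ((v ⊗ᵥ M) ⊗ᵥ[ p ] ⊗ᵥ M) j
        ≈⟨ ⊗ᵥ-distribʳ-+ᵛ M (c ·ᵛ v) ((v ⊗ᵥ M) ⊗ᵥ[ p ]) j ⟨
      (v ⊗ᵥ[ c ∷ p ] ⊗ᵥ M) j ∎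

    ⊗ᵥ[]-vanishes : ∀ v {p} → [] ≈ᶜ p → v ⊗ᵥ[ p ] ≋ 0ᵛ
    ⊗ᵥ[]-vanishes v {[]}    _    = ≋-refl
    ⊗ᵥ[]-vanishes v {c ∷ p} 0≈p j = begin
      c * v j + ((v ⊗ᵥ M) ⊗ᵥ[ p ]) j
        ≈⟨ +-cong (*-congʳ (sym (coeff-≈ 0≈p zero))) (⊗ᵥ[]-vanishes (v ⊗ᵥ M) {p} (mk≈ᶜ λ i → coeff-≈ 0≈p (suc i)) j) ⟩
      0# * v j + 0#
        ≈⟨ trans (+-identityʳ _) (zeroˡ (v j)) ⟩
      0# ∎

    ⊗ᵥ[]-congʳ : ∀ v {p r} → p ≈ᶜ r → v ⊗ᵥ[ p ] ≋ v ⊗ᵥ[ r ]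
    ⊗ᵥ[]-congʳ v {[]}    {r}     p≈r = ≋-sym (⊗ᵥ[]-vanishes v p≈r)
    ⊗ᵥ[]-congʳ v {c ∷ p} {[]}    p≈r = ⊗ᵥ[]-vanishes v (≈ᶜ-sym p≈r)
    ⊗ᵥ[]-congʳ v {c ∷ p} {d ∷ r} p≈r j =
      +-cong (*-congʳ (coeff-≈ p≈r zero)) (⊗ᵥ[]-congʳ (v ⊗ᵥ M) {p} {r} (mk≈ᶜ λ i → coeff-≈ p≈r (suc i)) j)

    ⊗ᵥ[]-+ₚ : ∀ v p r → v ⊗ᵥ[ p +ₚ r ] ≋ v ⊗ᵥ[ p ] +ᵛ v ⊗ᵥ[ r ]
    ⊗ᵥ[]-+ₚ v []      r       j = sym (+-identityˡ _)
    ⊗ᵥ[]-+ₚ v (c ∷ p) []      j = sym (+-identityʳ _)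
    ⊗ᵥ[]-+ₚ v (c ∷ p) (d ∷ r) j = begin
      (c + d) * v j + ((v ⊗ᵥ M) ⊗ᵥ[ p +ₚ r ]) j
        ≈⟨ +-cong (distribʳ (v j) c d) (⊗ᵥ[]-+ₚ (v ⊗ᵥ M) p r j) ⟩
      (c * v j + d * v j) + (((v ⊗ᵥ M) ⊗ᵥ[ p ]) j + ((v ⊗ᵥ M) ⊗ᵥ[ r ]) j)
        ≈⟨ interchange (c * v j) (d * v j) _ _ ⟩
      (v ⊗ᵥ[ c ∷ p ] +ᵛ v ⊗ᵥ[ d ∷ r ]) j ∎

    ⊗ᵥ[]-scaleₚ : ∀ v s p → v ⊗ᵥ[ scaleₚ s p ] ≋ s ·ᵛ v ⊗ᵥ[ p ]
    ⊗ᵥ[]-scaleₚ v s []      j = sym (zeroʳ s)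
    ⊗ᵥ[]-scaleₚ v s (c ∷ p) j = begin
      (s * c) * v j + ((v ⊗ᵥ M) ⊗ᵥ[ scaleₚ s p ]) j  ≈⟨ +-cong (*-assoc s c (v j)) (⊗ᵥ[]-scaleₚ (v ⊗ᵥ M) s p j) ⟩
      s * (c * v j) + s * ((v ⊗ᵥ M) ⊗ᵥ[ p ]) j       ≈⟨ distribˡ s _ _ ⟨
      s * (v ⊗ᵥ[ c ∷ p ]) j                          ∎

    ⊗ᵥ[]-shift : ∀ v p → v ⊗ᵥ[ 0# ∷ p ] ≋ (v ⊗ᵥ M) ⊗ᵥ[ p ]
    ⊗ᵥ[]-shift v p j = trans (+-congʳ (zeroˡ (v j))) (+-identityˡ _)

    ⊗ᵥ[]-*ₚ : ∀ v p r → v ⊗ᵥ[ p *ₚ r ] ≋ v ⊗ᵥ[ p ] ⊗ᵥ[ r ]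
    ⊗ᵥ[]-*ₚ v []      r = ≋-sym (⊗ᵥ[]-zeroˡ r)
    ⊗ᵥ[]-*ₚ v (c ∷ p) r j = begin
      (v ⊗ᵥ[ scaleₚ c r +ₚ (0# ∷ (p *ₚ r)) ]) j
        ≈⟨ ⊗ᵥ[]-+ₚ v (scaleₚ c r) (0# ∷ (p *ₚ r)) j ⟩
      (v ⊗ᵥ[ scaleₚ c r ]) j + (v ⊗ᵥ[ 0# ∷ (p *ₚ r) ]) j
        ≈⟨ +-cong (⊗ᵥ[]-scaleₚ v c r j) (≋-trans (⊗ᵥ[]-shift v (p *ₚ r)) (⊗ᵥ[]-*ₚ (v ⊗ᵥ M) p r) j) ⟩
      c * (v ⊗ᵥ[ r ]) j + ((v ⊗ᵥ M) ⊗ᵥ[ p ] ⊗ᵥ[ r ]) j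
        ≈⟨ +-congʳ (⊗ᵥ[]-·ᵛ r c v j) ⟨
      ((c ·ᵛ v) ⊗ᵥ[ r ]) j + ((v ⊗ᵥ M) ⊗ᵥ[ p ] ⊗ᵥ[ r ]) j
        ≈⟨ ⊗ᵥ[]-distribʳ-+ᵛ r (c ·ᵛ v) ((v ⊗ᵥ M) ⊗ᵥ[ p ]) j ⟨
      (v ⊗ᵥ[ c ∷ p ] ⊗ᵥ[ r ]) j ∎

    xᵈ : ℕ → Poly
    xᵈ d = replicate d 0# ++ₗ (1# ∷ [])

    ⊗ᵥ[]-xᵈ : ∀ v d → v ⊗ᵥ[ xᵈ d ] ≋ fold v (_⊗ᵥ M) d
    ⊗ᵥ[]-xᵈ v d = ≋-trans (iterated v d) (≋-reflexive (≡.sym (iterate-is-fold v (_⊗ᵥ M) d)))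
      where
      iterated : ∀ v d → v ⊗ᵥ[ xᵈ d ] ≋ iterate (_⊗ᵥ M) v d
      iterated v zero    j = trans (+-cong (*-identityˡ (v j)) refl) (+-identityʳ (v j))
      iterated v (suc d) = ≋-trans (⊗ᵥ[]-shift v (xᵈ d)) (iterated (v ⊗ᵥ M) d)

    e₀ : Vect (suc k)
    e₀ Fin.zero    = 1#
    e₀ (Fin.suc _) = 0#

    toPoly-e₀ : toPoly e₀ ≈ᶜ 1# ∷ []
    toPoly-e₀ = ∷-cong refl toPoly-0ᵛ

    f : Poly
    f = monicPoly a

    e₀-⊗ᵥ[]-coeff : ∀ p → length p ℕ.≤ suc k → e₀ ⊗ᵥ[ p ] ≋ λ j → coeff p (toℕ j)
    e₀-⊗ᵥ[]-coeff []      _            j = refl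
    e₀-⊗ᵥ[]-coeff (c ∷ p) (ℕ.s≤s p≤k) j = begin
      c * e₀ j + ((e₀ ⊗ᵥ M) ⊗ᵥ[ p ]) j
        ≈⟨ +-congˡ (≋-trans (⊗ᵥ[]-⊗ᵥ-comm p e₀) (⊗ᵥ-congˡ M (e₀-⊗ᵥ[]-coeff p (ℕₚ.m≤n⇒m≤1+n p≤k))) j) ⟩
      c * e₀ j + (g ⊗ᵥ M) j
        ≈⟨ +-congˡ (⊗ᵥ-companion g j) ⟩
      c * e₀ j + (shift g j - last g * a j)
        ≈⟨ +-congˡ (+-congˡ (trans (-‿cong (trans (*-congʳ (reflexive last-g≡0)) (zeroˡ (a j)))) ε⁻¹≈ε)) ⟩
      c * e₀ j + (shift g j + 0#)
        ≈⟨ trans (+-congˡ (+-identityʳ _)) (shifted j) ⟩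
      coeff (c ∷ p) (toℕ j) ∎
      where
      g : Vect (suc k)
      g j = coeff p (toℕ j)
      last-g≡0 : last g ≡ 0#
      last-g≡0 = ≡.trans (≡.cong (coeff p) (Finₚ.toℕ-fromℕ k)) (coeff-beyond-length p k p≤k)
      shifted : ∀ j → c * e₀ j + shift g j ≈ coeff (c ∷ p) (toℕ j)
      shifted Fin.zero    = trans (+-identityʳ _) (*-identityʳ c)
      shifted (Fin.suc j) =
        trans (+-congʳ (zeroʳ c)) (trans (+-identityˡ _) (reflexive (≡.cong (coeff p) (Finₚ.toℕ-inject₁ j))))

    e₀-⊗ᵥ[toPoly] : ∀ v → e₀ ⊗ᵥ[ toPoly v ] ≋ v
    e₀-⊗ᵥ[toPoly] v j =
      trans (e₀-⊗ᵥ[]-coeff (toPoly v) (ℕₚ.≤-reflexive (length-toPoly v)) j) (reflexive (coeff-toPoly v j))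

    -- In the basis 1, x, …, xᵏ of F[x]/(f), multiplication by x acts as M on row vectors.
    x*toPoly : ∀ v → 0# ∷ toPoly v ≈ᶜ toPoly (v ⊗ᵥ M) +ₚ scaleₚ (last v) f
    x*toPoly v =
      ≈ᶜ-trans (≈ᶜ-reflexive (≡.cong (0# ∷_) (toPoly-init-last v)))
      (≈ᶜ-trans (≈ᶜ-sym (toPoly-+ₚ-scaleₚ-monicPoly (shift v) a (last v)))
                (+ₚ-cong (toPoly-cong (λ j → sym (⊗ᵥ-companion v j))) (≈ᶜ-refl {scaleₚ (last v) f})))

    -- Apply e₀ ⊗ᵥ[_] to x*toPoly 𝟙: both sides contain 𝟙 ⊗ᵥ M, and e₀ ⊗ᵥ[ f ] is what remains.
    e₀-⊗ᵥ[f] : e₀ ⊗ᵥ[ f ] ≋ 0ᵛ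
    e₀-⊗ᵥ[f] j = identityʳ-unique _ _ (sym (begin
      (𝟙 ⊗ᵥ M) j
        ≈⟨ ⊗ᵥ-congˡ M (e₀-⊗ᵥ[toPoly] 𝟙) j ⟨
      (e₀ ⊗ᵥ[ toPoly 𝟙 ] ⊗ᵥ M) j
        ≈⟨ ≋-trans (⊗ᵥ[]-shift e₀ (toPoly 𝟙)) (⊗ᵥ[]-⊗ᵥ-comm (toPoly 𝟙) e₀) j ⟨
      (e₀ ⊗ᵥ[ 0# ∷ toPoly 𝟙 ]) j
        ≈⟨ ⊗ᵥ[]-congʳ e₀ (x*toPoly 𝟙) j ⟩
      (e₀ ⊗ᵥ[ toPoly (𝟙 ⊗ᵥ M) +ₚ scaleₚ 1# f ]) j
        ≈⟨ ⊗ᵥ[]-+ₚ e₀ (toPoly (𝟙 ⊗ᵥ M)) (scaleₚ 1# f) j ⟩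
      (e₀ ⊗ᵥ[ toPoly (𝟙 ⊗ᵥ M) ]) j + (e₀ ⊗ᵥ[ scaleₚ 1# f ]) j
        ≈⟨ +-cong (e₀-⊗ᵥ[toPoly] (𝟙 ⊗ᵥ M) j) (trans (⊗ᵥ[]-scaleₚ e₀ 1# f j) (*-identityˡ _)) ⟩
      (𝟙 ⊗ᵥ M) j + (e₀ ⊗ᵥ[ f ]) j ∎))
      where
      𝟙 : Vect (suc k)
      𝟙 _ = 1#

    e₀M^ : ℕ → Vect (suc k)
    e₀M^ d = fold e₀ (_⊗ᵥ M) d

    quotient : ℕ → Poly
    quotient zero    = []
    quotient (suc d) = (0# ∷ quotient d) +ₚ (last (e₀M^ d) ∷ [])

    f*quotient-suc : ∀ d → (f *ₚ (0# ∷ quotient d)) +ₚ scaleₚ (last (e₀M^ d)) f ≈ᶜ f *ₚ quotient (suc d)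
    f*quotient-suc d = ≈ᶜ-sym (≈ᶜ-trans (*ₚ-distribˡ-+ₚ f (0# ∷ quotient d) (last (e₀M^ d) ∷ []))
                                        (+ₚ-cong (≈ᶜ-refl {f *ₚ (0# ∷ quotient d)}) (*ₚ-constʳ f (last (e₀M^ d)))))

    xᵈ-division : ∀ d → xᵈ d ≈ᶜ (f *ₚ quotient d) +ₚ toPoly (e₀M^ d)
    xᵈ-division zero    = ≈ᶜ-sym (+ₚ-cong (*ₚ-zeroʳ f) toPoly-e₀)
    xᵈ-division (suc d) =
      ≈ᶜ-trans (∷-cong (sym (+-identityˡ 0#)) (xᵈ-division d))
      (≈ᶜ-trans (+ₚ-cong (≈ᶜ-sym (*ₚ-shiftʳ f (quotient d))) (x*toPoly (e₀M^ d)))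
      (≈ᶜ-trans (+ₚ-rotate (f *ₚ (0# ∷ quotient d)) (toPoly (e₀M^ (suc d))) (scaleₚ (last (e₀M^ d)) f))
                (+ₚ-cong (f*quotient-suc d) (≈ᶜ-refl {toPoly (e₀M^ (suc d))}))))

    ∣ₚxᵈ-1⇒e₀M^≋e₀ : ∀ d → f ∣ₚ xpow-1 d → e₀M^ d ≋ e₀
    ∣ₚxᵈ-1⇒e₀M^≋e₀ d (h , fh≈xᵈ-1) = -ᵛ≋0ᵛ⇒≋ λ j → begin
      e₀M^ d j - e₀ j
        ≈⟨ +-cong (⊗ᵥ[]-xᵈ e₀ d j) (trans (+-identityʳ _) (-1*x≈-x (e₀ j))) ⟨
      (e₀ ⊗ᵥ[ xᵈ d ]) j + (e₀ ⊗ᵥ[ - 1# ∷ [] ]) j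
        ≈⟨ ⊗ᵥ[]-+ₚ e₀ (xᵈ d) (- 1# ∷ []) j ⟨
      (e₀ ⊗ᵥ[ xpow-1 d ]) j
        ≈⟨ ⊗ᵥ[]-congʳ e₀ (≈ₚ⇒≈ᶜ (f *ₚ h) (xpow-1 d) fh≈xᵈ-1) j ⟨
      (e₀ ⊗ᵥ[ f *ₚ h ]) j
        ≈⟨ ⊗ᵥ[]-*ₚ e₀ f h j ⟩
      (e₀ ⊗ᵥ[ f ] ⊗ᵥ[ h ]) j
        ≈⟨ ≋-trans (⊗ᵥ[]-congˡ h e₀-⊗ᵥ[f]) (⊗ᵥ[]-zeroˡ h) j ⟩
      0# ∎

    e₀M^≋e₀⇒∣ₚxᵈ-1 : ∀ d → e₀M^ d ≋ e₀ → f ∣ₚ xpow-1 d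
    e₀M^≋e₀⇒∣ₚxᵈ-1 d e₀Mᵈ≋e₀ = quotient d , ≈ᶜ⇒≈ₚ (f *ₚ quotient d) (xpow-1 d) (≈ᶜ-sym xᵈ-1≈fq)
      where
      fq : Poly
      fq = f *ₚ quotient d
      xᵈ-1≈fq : xpow-1 d ≈ᶜ fq
      xᵈ-1≈fq =
        ≈ᶜ-trans (+ₚ-cong (≈ᶜ-trans (xᵈ-division d)
                                    (+ₚ-cong (≈ᶜ-refl {fq}) (≈ᶜ-trans (toPoly-cong e₀Mᵈ≋e₀) toPoly-e₀)))
                          (≈ᶜ-refl {(- 1#) ∷ []}))
        (≈ᶜ-trans (+ₚ-assoc fq (1# ∷ []) (- 1# ∷ []))
        (≈ᶜ-trans (+ₚ-cong (≈ᶜ-refl {fq}) (mk≈ᶜ λ { zero → -‿inverseʳ 1# ; (suc i) → refl }))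
                  (≈ᶜ-reflexive (+ₚ-identityʳ fq))))

  module Period {k : ℕ} (a : Vect (suc k)) (isPrimitive : Primitive a) where
    open Companion a

    N : ℕ
    N = q ℕ.^ suc k ℕ.∸ 1

    a₀≉0 : ¬ a Fin.zero ≈ 0#
    a₀≉0 = proj₁ isPrimitive

    order : IsOrder f N
    order = proj₂ isPrimitive

    1≤N : 1 ℕ.≤ N
    1≤N = proj₁ order

    f∣ₚxᴺ-1 : f ∣ₚ xpow-1 N
    f∣ₚxᴺ-1 = proj₁ (proj₂ order)

    order-minimal : ∀ d → 1 ℕ.≤ d → f ∣ₚ xpow-1 d → N ℕ.≤ d
    order-minimal = proj₂ (proj₂ order)

    instance
      N≢0 : ℕ.NonZero N
      N≢0 = ℕ.>-nonZero 1≤N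

    qᵏ⁺¹≡1+N : q ℕ.^ suc k ≡ suc N
    qᵏ⁺¹≡1+N = ≡.trans (≡.sym (ℕₚ.m∸n+n≡m (ℕₚ.≤-trans 1≤N (ℕₚ.m∸n≤m _ 1)))) (ℕₚ.+-comm N 1)

    e₀M^N≋e₀ : e₀M^ N ≋ e₀
    e₀M^N≋e₀ = ∣ₚxᵈ-1⇒e₀M^≋e₀ N f∣ₚxᴺ-1

    e₀M^≉e₀ : ∀ {d} → 1 ℕ.≤ d → d ℕ.< N → ¬ e₀M^ d ≋ e₀
    e₀M^≉e₀ {d} 1≤d d<N e₀Mᵈ≋e₀ = ℕₚ.<⇒≱ d<N (order-minimal d 1≤d (e₀M^≋e₀⇒∣ₚxᵈ-1 d e₀Mᵈ≋e₀))

    e₀M^≉0ᵛ : ∀ i → ¬ e₀M^ i ≋ 0ᵛ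
    e₀M^≉0ᵛ i e₀Mⁱ≋0 =
      0≉1 (sym (fold-⊗ᵥ-companion-cancel a₀≉0 i (≋-trans e₀Mⁱ≋0 (≋-sym (fold-⊗ᵥ-0ᵛ M i))) Fin.zero))

    e₀M^-injective : ∀ {i j} → i ℕ.< j → j ℕ.< N → ¬ e₀M^ i ≋ e₀M^ j
    e₀M^-injective {i} {j} i<j j<N e₀Mⁱ≋e₀Mʲ =
      e₀M^≉e₀ (ℕₚ.m<n⇒0<n∸m i<j) (ℕₚ.≤-<-trans (ℕₚ.m∸n≤m j i) j<N)
        (≋-sym (fold-⊗ᵥ-companion-cancel a₀≉0 i (≋-trans e₀Mⁱ≋e₀Mʲ (≋-reflexive e₀Mʲ≡e₀M^[j-i]Mⁱ))))
      where
      e₀Mʲ≡e₀M^[j-i]Mⁱ : e₀M^ j ≡ fold (e₀M^ (j ℕ.∸ i)) (_⊗ᵥ M) i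
      e₀Mʲ≡e₀M^[j-i]Mⁱ =
        ≡.trans (≡.cong e₀M^ (≡.sym (ℕₚ.m+[n∸m]≡n (ℕₚ.<⇒≤ i<j)))) (fold-+ e₀ (_⊗ᵥ M) i)

    0ᵛ∷y∷e₀M^ : Vect (suc k) → Fin (suc (suc N)) → Vect (suc k)
    0ᵛ∷y∷e₀M^ y Fin.zero              = 0ᵛ
    0ᵛ∷y∷e₀M^ y (Fin.suc Fin.zero)    = y
    0ᵛ∷y∷e₀M^ y (Fin.suc (Fin.suc j)) = e₀M^ (toℕ j)

    -- The N + 2 vectors 0, y, e₀M⁰, …, e₀M^(N−1) cannot be pairwise distinct among the
    -- q^(k+1) = N + 1 vectors of F^(k+1).
    e₀M^-surjective : ∀ {y} → ¬ y ≋ 0ᵛ → ∃ λ j → y ≋ e₀M^ j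
    e₀M^-surjective {y} y≉0 with Vect-pigeonhole (ℕₚ.≤-reflexive (≡.cong suc qᵏ⁺¹≡1+N)) (0ᵛ∷y∷e₀M^ y)
    ... | Fin.zero , Fin.suc Fin.zero , _ , 0≋y = ⊥-elim (y≉0 (≋-sym 0≋y))
    ... | Fin.zero , Fin.suc (Fin.suc j) , _ , 0≋e₀Mʲ = ⊥-elim (e₀M^≉0ᵛ (toℕ j) (≋-sym 0≋e₀Mʲ))
    ... | Fin.suc Fin.zero , Fin.suc (Fin.suc j) , _ , y≋e₀Mʲ = toℕ j , y≋e₀Mʲ
    ... | Fin.suc (Fin.suc i) , Fin.suc (Fin.suc j) , ℕ.s≤s (ℕ.s≤s i<j) , e₀Mⁱ≋e₀Mʲ =
      ⊥-elim (e₀M^-injective i<j (Finₚ.toℕ<n j) e₀Mⁱ≋e₀Mʲ)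
    ... | Fin.suc Fin.zero , Fin.suc Fin.zero , ℕ.s≤s () , _
    ... | Fin.suc (Fin.suc i) , Fin.suc Fin.zero , ℕ.s≤s () , _

    fold-period : ∀ y → fold y (_⊗ᵥ M) N ≋ y
    fold-period y with Pointwise.decidable _≈?_ y 0ᵛ
    ... | yes y≋0 = ≋-trans (fold-⊗ᵥ-cong M N y≋0) (≋-trans (fold-⊗ᵥ-0ᵛ M N) (≋-sym y≋0))
    ... | no y≉0 with e₀M^-surjective y≉0
    ...   | j , y≋e₀Mʲ =
      ≋-trans (fold-⊗ᵥ-cong M N y≋e₀Mʲ)
      (≋-trans (≋-reflexive (fold-comm (_⊗ᵥ M) e₀ j N))
      (≋-trans (fold-⊗ᵥ-cong M j e₀M^N≋e₀) (≋-sym y≋e₀Mʲ)))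

    fold-fixed⇒≋0ᵛ : ∀ {d y} → 1 ℕ.≤ d → d ℕ.< N → fold y (_⊗ᵥ M) d ≋ y → y ≋ 0ᵛ
    fold-fixed⇒≋0ᵛ {d} {y} 1≤d d<N yMᵈ≋y with Pointwise.decidable _≈?_ y 0ᵛ
    ... | yes y≋0 = y≋0
    ... | no y≉0 with e₀M^-surjective y≉0
    ...   | j , y≋e₀Mʲ = ⊥-elim (e₀M^≉e₀ 1≤d d<N (fold-⊗ᵥ-companion-cancel a₀≉0 j
      (≋-trans (≋-reflexive (fold-comm (_⊗ᵥ M) e₀ d j))
      (≋-trans (fold-⊗ᵥ-cong M d (≋-sym y≋e₀Mʲ)) (≋-trans yMᵈ≋y y≋e₀Mʲ)))))

    -- Applying M^(N−j) to yMⁱ ≋ yMʲ makes y a fixed vector of M^(N−j+i).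
    fold-separates-< : ∀ {i j y} → i ℕ.< j → j ℕ.< N → fold y (_⊗ᵥ M) i ≋ fold y (_⊗ᵥ M) j → y ≋ 0ᵛ
    fold-separates-< {i} {j} {y} i<j j<N yMⁱ≋yMʲ = fold-fixed⇒≋0ᵛ 1≤d d<N
      (≋-trans (≋-reflexive (fold-+ y (_⊗ᵥ M) (N ℕ.∸ j)))
      (≋-trans (fold-⊗ᵥ-cong M (N ℕ.∸ j) yMⁱ≋yMʲ)
      (≋-trans (≋-reflexive (≡.trans (≡.sym (fold-+ y (_⊗ᵥ M) (N ℕ.∸ j)))
                                     (≡.cong (fold y (_⊗ᵥ M)) (ℕₚ.m∸n+n≡m (ℕₚ.<⇒≤ j<N)))))
               (fold-period y))))
      where
      1≤d : 1 ℕ.≤ (N ℕ.∸ j) ℕ.+ i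
      1≤d = ℕₚ.≤-trans (ℕₚ.m<n⇒0<n∸m j<N) (ℕₚ.m≤m+n (N ℕ.∸ j) i)
      d<N : (N ℕ.∸ j) ℕ.+ i ℕ.< N
      d<N = ℕₚ.<-≤-trans (ℕₚ.+-monoʳ-< (N ℕ.∸ j) i<j) (ℕₚ.≤-reflexive (ℕₚ.m∸n+n≡m (ℕₚ.<⇒≤ j<N)))

    fold-separates : ∀ {y} (i j : Fin N) → i ≢ j → fold y (_⊗ᵥ M) (toℕ i) ≋ fold y (_⊗ᵥ M) (toℕ j) → y ≋ 0ᵛ
    fold-separates i j i≢j yMⁱ≋yMʲ with ℕₚ.<-cmp (toℕ i) (toℕ j)
    ... | tri< i<j _ _ = fold-separates-< i<j (Finₚ.toℕ<n j) yMⁱ≋yMʲ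
    ... | tri≈ _ i≡j _ = ⊥-elim (i≢j (Finₚ.toℕ-injective i≡j))
    ... | tri> _ _ j<i = fold-separates-< j<i (Finₚ.toℕ<n i) (≋-sym yMⁱ≋yMʲ)

    fold-mod : ∀ e y → fold y (_⊗ᵥ M) e ≋ fold y (_⊗ᵥ M) (toℕ (e mod N))
    fold-mod e y =
      ≋-trans (≋-reflexive (≡.trans (≡.cong (fold y (_⊗ᵥ M)) (DivMod.m≡m%n+[m/n]*n e N)) (fold-+ y (_⊗ᵥ M) (e % N))))
      (≋-trans (fold-⊗ᵥ-cong M (e % N) (fold-multiple (e / N)))
               (≋-reflexive (≡.cong (fold y (_⊗ᵥ M)) (≡.sym (Finₚ.toℕ-fromℕ< (DivMod.m%n<n e N))))))
      where
      fold-multiple : ∀ b → fold y (_⊗ᵥ M) (b ℕ.* N) ≋ y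
      fold-multiple zero    = ≋-refl
      fold-multiple (suc b) = ≋-trans (≋-reflexive (fold-+ y (_⊗ᵥ M) N))
                                      (≋-trans (fold-period (fold y (_⊗ᵥ M) (b ℕ.* N))) (fold-multiple b))

  module Spread {k : ℕ} (1≤k : 1 ℕ.≤ k) (a : Vect (suc k)) (isPrimitive : Primitive a)
                (U₁ : Mat k k) (U₂ : Mat k (suc k)) (U₁-full : FullRowRank U₁) (U₂-full : FullRowRank U₂) where
    open Companion a
    open Period a isPrimitive

    pattern U′        = Fin.zero
    pattern U″        = Fin.suc Fin.zero
    pattern orbit i   = Fin.suc (Fin.suc i)

    orbitGenerator : ℕ → Mat k (k ℕ.+ suc k)
    orbitGenerator e = (U₁ ∣∣ U₂) ⊗ (gMat k a ^ᴹ e)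

    generator : Fin (suc (suc N)) → Mat k (k ℕ.+ suc k)
    generator U′        = U₁ ∣∣ zeroMat
    generator U″        = zeroMat ∣∣ U₂
    generator (orbit i) = orbitGenerator (toℕ i)

    member : Fin (suc (suc N)) → Gen (k ℕ.+ suc k)
    member s = rowsp (generator s)

    ⊗ᵥ-orbitGenerator : ∀ e c → c ⊗ᵥ orbitGenerator e ≋ (c ⊗ᵥ U₁) ++ fold (c ⊗ᵥ U₂) (_⊗ᵥ M) e
    ⊗ᵥ-orbitGenerator e c =
      ≋-trans (⊗ᵥ-assoc c (U₁ ∣∣ U₂) (gMat k a ^ᴹ e))
      (≋-trans (⊗ᵥ-^ᴹ (gMat k a) e (c ⊗ᵥ (U₁ ∣∣ U₂)))
      (≋-trans (fold-⊗ᵥ-cong (gMat k a) e (⊗ᵥ-∣∣ c U₁ U₂))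
               (fold-⊗ᵥ-blockDiag-idMat M e (c ⊗ᵥ U₁) (c ⊗ᵥ U₂))))

    combination : Fin (suc (suc N)) → Vect k → Vect (k ℕ.+ suc k)
    combination U′        c = (c ⊗ᵥ U₁) ++ 0ᵛ
    combination U″        c = 0ᵛ ++ (c ⊗ᵥ U₂)
    combination (orbit i) c = (c ⊗ᵥ U₁) ++ fold (c ⊗ᵥ U₂) (_⊗ᵥ M) (toℕ i)

    ⊗ᵥ-generator : ∀ s c → c ⊗ᵥ generator s ≋ combination s c
    ⊗ᵥ-generator U′        c =
      ≋-trans (⊗ᵥ-∣∣ c U₁ zeroMat) (Pointwise.++⁺ _≈_ {k} {xs = c ⊗ᵥ U₁} ≋-refl (⊗ᵥ-zeroʳ c))
    ⊗ᵥ-generator U″        c =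
      ≋-trans (⊗ᵥ-∣∣ c zeroMat U₂) (Pointwise.++⁺ _≈_ {k} {xs′ = c ⊗ᵥ U₂} (⊗ᵥ-zeroʳ c) ≋-refl)
    ⊗ᵥ-generator (orbit i) c = ⊗ᵥ-orbitGenerator (toℕ i) c

    orbitGenerator-mod : ∀ e → rowsp (orbitGenerator e) ≐ member (orbit (e mod N))
    orbitGenerator-mod e = rowsp-≐ (orbitGenerator e) (generator (orbit (e mod N))) λ c →
      ≋-trans (⊗ᵥ-orbitGenerator e c)
      (≋-trans (Pointwise.++⁺ _≈_ ≋-refl (fold-mod e (c ⊗ᵥ U₂))) (≋-sym (⊗ᵥ-orbitGenerator (toℕ (e mod N)) c)))

    generator-full : ∀ s → FullRowRank (generator s)
    generator-full U′        c cG≋0 = U₁-full c (proj₁ (++≋0ᵛ⇒ (≋-trans (≋-sym (⊗ᵥ-generator U′ c)) cG≋0)))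
    generator-full U″        c cG≋0 = U₂-full c (proj₂ (++≋0ᵛ⇒ (≋-trans (≋-sym (⊗ᵥ-generator U″ c)) cG≋0)))
    generator-full (orbit i) c cG≋0 =
      U₁-full c (proj₁ (++≋0ᵛ⇒ {u = c ⊗ᵥ U₁} (≋-trans (≋-sym (⊗ᵥ-generator (orbit i) c)) cG≋0)))

    trivialIntersection-via-coefficients : ∀ s t → (∀ c c′ → combination s c ≋ combination t c′ → c ≋ 0ᵛ) →
                                           TrivialIntersection (member s) (member t)
    trivialIntersection-via-coefficients s t only-0 v (c , v≋cGₛ) (c′ , v≋c′Gₜ) =
      ≋-trans v≋cGₛ (≋-trans (⊗ᵥ-congˡ (generator s) c≋0) (⊗ᵥ-zeroˡ (generator s)))
      where
      c≋0 : c ≋ 0ᵛ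
      c≋0 = only-0 c c′ (≋-trans (≋-sym (⊗ᵥ-generator s c))
                        (≋-trans (≋-sym v≋cGₛ) (≋-trans v≋c′Gₜ (⊗ᵥ-generator t c′))))

    distinct-orbits-meet-at-0 : ∀ i j → i ≢ j → ∀ c c′ →
                                combination (orbit i) c ≋ combination (orbit j) c′ → c ≋ 0ᵛ
    distinct-orbits-meet-at-0 i j i≢j c c′ eq = U₂-full c (fold-separates i j i≢j (≋-trans cU₂Mⁱ≋c′U₂Mʲ
                                                (fold-⊗ᵥ-cong M (toℕ j) (⊗ᵥ-congˡ U₂ (≋-sym c≋c′)))))
      where
      cU₂Mⁱ≋c′U₂Mʲ : fold (c ⊗ᵥ U₂) (_⊗ᵥ M) (toℕ i) ≋ fold (c′ ⊗ᵥ U₂) (_⊗ᵥ M) (toℕ j)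
      cU₂Mⁱ≋c′U₂Mʲ = Pointwise.++⁻ʳ _≈_ (c ⊗ᵥ U₁) (c′ ⊗ᵥ U₁) eq
      c≋c′ : c ≋ c′
      c≋c′ = ⊗ᵥ-cancelʳ U₁-full (Pointwise.++⁻ˡ _≈_ (c ⊗ᵥ U₁) (c′ ⊗ᵥ U₁) eq)

    member-TI : ∀ s t → s ≢ t → TrivialIntersection (member s) (member t)
    member-TI U′        U′        U′≢U′ = ⊥-elim (U′≢U′ ≡.refl)
    member-TI U″        U″        U″≢U″ = ⊥-elim (U″≢U″ ≡.refl)
    member-TI U′        U″        _     = trivialIntersection-via-coefficients U′ U″ λ c c′ eq →
      U₁-full c (Pointwise.++⁻ˡ _≈_ (c ⊗ᵥ U₁) 0ᵛ eq)
    member-TI (orbit i) U′        _     = trivialIntersection-via-coefficients (orbit i) U′ λ c c′ eq →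
      U₂-full c (fold-⊗ᵥ-companion-cancel a₀≉0 (toℕ i)
                  (≋-trans (Pointwise.++⁻ʳ _≈_ (c ⊗ᵥ U₁) (c′ ⊗ᵥ U₁) eq) (≋-sym (fold-⊗ᵥ-0ᵛ M (toℕ i)))))
    member-TI (orbit i) U″        _     = trivialIntersection-via-coefficients (orbit i) U″ λ c c′ eq →
      U₁-full c (Pointwise.++⁻ˡ _≈_ (c ⊗ᵥ U₁) 0ᵛ eq)
    member-TI (orbit i) (orbit j) i≢j   =
      trivialIntersection-via-coefficients (orbit i) (orbit j) (distinct-orbits-meet-at-0 i j (i≢j ∘ ≡.cong orbit))
    member-TI U′        (orbit j) _     = TrivialIntersection-sym (member-TI (orbit j) U′ λ ())
    member-TI U″        U′        _     = TrivialIntersection-sym (member-TI U′ U″ λ ())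
    member-TI U″        (orbit j) _     = TrivialIntersection-sym (member-TI (orbit j) U″ λ ())

    member-injective : ∀ s t → member s ≐ member t → s ≡ t
    member-injective s t s≐t with s Fin.≟ t
    ... | yes s≡t = s≡t
    ... | no s≢t  = ⊥-elim (0≉1 (sym (generator-full s 𝟙 𝟙Gₛ≋0 (Fin.fromℕ< 1≤k))))
      where
      𝟙 : Vect k
      𝟙 _ = 1#
      𝟙Gₛ∈s : (𝟙 ⊗ᵥ generator s) ∈ member s
      𝟙Gₛ∈s = 𝟙 , ≋-refl
      𝟙Gₛ≋0 : 𝟙 ⊗ᵥ generator s ≋ 0ᵛ
      𝟙Gₛ≋0 = member-TI s t s≢t (𝟙 ⊗ᵥ generator s) 𝟙Gₛ∈s (proj₁ (s≐t (𝟙 ⊗ᵥ generator s)) 𝟙Gₛ∈s)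

    spread : Family (k ℕ.+ suc k)
    spread = SpreadFamily k a U₁ U₂

    classify : ∀ W → spread W → ∃ λ s → W ≐ member s
    classify W (inj₁ (e , W≐orbit))   = orbit (e mod N) , ≐-trans W≐orbit (orbitGenerator-mod e)
    classify W (inj₂ (inj₁ W≐U′))     = U′ , W≐U′
    classify W (inj₂ (inj₂ W≐U″))     = U″ , W≐U″

    member∈spread : ∀ s → spread (member s)
    member∈spread U′        = inj₂ (inj₁ ≐-refl)
    member∈spread U″        = inj₂ (inj₂ ≐-refl)
    member∈spread (orbit i) = inj₁ (toℕ i , ≐-refl)

    isPartialSpread : IsPartialSpread k spread
    isPartialSpread =
      dimension-k , disjoint ,
      member U′ , member U″ , member∈spread U′ , member∈spread U″ ,
      (λ U′≐U″ → case member-injective U′ U″ U′≐U″ of λ ())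
      where
      dimension-k : ∀ W → spread W → HasDim W k
      dimension-k W W∈F with classify W W∈F
      ... | s , W≐s = generator s , generator-full s , ≐-sym W≐s
      disjoint : ∀ W W′ → spread W → spread W′ → ¬ W ≐ W′ → TrivialIntersection W W′
      disjoint W W′ W∈F W′∈F W≭W′ with classify W W∈F | classify W′ W′∈F
      ... | s , W≐s | t , W′≐t with s Fin.≟ t
      ...   | yes ≡.refl = ⊥-elim (W≭W′ (≐-trans W≐s (≐-sym W′≐t)))
      ...   | no s≢t     = TrivialIntersection-resp-≐ W≐s W′≐t (member-TI s t s≢t)

    hasCardinality : HasCardinality spread (q ℕ.^ suc k ℕ.+ 1)
    hasCardinality =
      ≡.subst (HasCardinality spread) 2+N≡qᵏ⁺¹+1 (member , member∈spread , classify , member-injective)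
      where
      2+N≡qᵏ⁺¹+1 : suc (suc N) ≡ q ℕ.^ suc k ℕ.+ 1
      2+N≡qᵏ⁺¹+1 = ≡.trans (ℕₚ.+-comm 1 (suc N)) (≡.cong (ℕ._+ 1) (≡.sym qᵏ⁺¹≡1+N))

open import Data.Nat using (_<_; _+_; _^_)

proposition5p9 : (F : FiniteField) → let open FieldDefs F in
    ∀ (k : ℕ) → 1 < k
    → (a : Fin (suc k) → Elt) → Primitive a
    → (U₁ : Mat k k) (U₂ : Mat k (suc k))
    → FullRowRank U₁ → FullRowRank U₂
    → IsPartialSpread k (SpreadFamily k a U₁ U₂)
      × HasCardinality (SpreadFamily k a U₁ U₂) (q ^ suc k + 1)
proposition5p9 F k 1<k a isPrimitive U₁ U₂ U₁-full U₂-full = isPartialSpread , hasCardinality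
  where open Spread F (ℕₚ.<⇒≤ 1<k) a isPrimitive U₁ U₂ U₁-full U₂-full
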